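{- Let $q=p^n$ be a prime power, $r\in\mathbb{Z}_{\ge2}$, $k=\frac{q^r-1}{q-1}$, and $0\le a,b\le q-2$. Define $A_r(a):=-(q-2)$ if ($r$ is even and $a=0$), or ($r$ is odd, $q$ even and $a=0$), or ($r$ odd, $q$ odd and $a=\frac{q-1}{2}$); and $A_r(a):=1$ otherwise. Define $B(b):=-(q-2)$ if $b=0$ and $B(b):=1$ if $b\ne0$; $C(a,b):=-(q-2)$ if $a=b$ and $C(a,b):=1$ if $a\neq b$. Put $M_{a,b}:=\frac{q^r-2+A_r(a)+B(b)+C(a,b)}{(q-1)^2}$. Then $(a,b)_{q-1}=M_{a,b}+E_{a,b}$ with $|E_{a,b}|\le\frac{(q-2)(q-3)}{(q-1)^2}q^{r/2}$.
   Context: Fix a generator $\omega$ of $\mathbb{F}_{q^r}^\times$; let $e=q-1$, $C_a:=\omega^a\langle\omega^e\rangle$ and $(a,b)_e:=\#\{x\in C_a\mid x+1\in C_b\}$. -}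

module Defs where

open import Level using (Level; _⊔_)
open import Data.Nat as ℕ using (ℕ; zero; suc; _∸_; _≡ᵇ_; _%_)
open import Data.Integer as ℤ using (ℤ; +_)
open import Data.Bool using (Bool; true; false; if_then_else_; _∧_; _∨_; not)
open import Data.Fin using (Fin; toℕ)
open import Data.Product using (Σ; ∃; _×_; _,_)
open import Relation.Nullary using (¬_; Dec; yes; no)
open import Relation.Binary using (Decidable)
open import Data.List using (List; length; filter)
open import Data.List using (allFin)
open import Data.Fin.Properties using (any?)
open import Relation.Unary using (Pred)
open import Relation.Binary.PropositionalEquality using (_≡_)
open import Relation.Nullary.Decidable using (_×-dec_)
open import Algebra.Bundles using (CommutativeRing)

module _ {c ℓ} (R : CommutativeRing c ℓ) where
  open CommutativeRing R
  pow : Carrier → ℕ → Carrier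
  pow x zero    = 1#
  pow x (suc n) = x * pow x n

record FiniteFieldWithGenerator (c ℓ : Level) (N : ℕ) : Set (Level.suc (c ⊔ ℓ)) where
  field
    fieldRing     : CommutativeRing c ℓ
  open CommutativeRing fieldRing public
  field
    0≉1      : ¬ (0# ≈ 1#)
    inverse  : ∀ x → ¬ (x ≈ 0#) → ∃ λ y → x * y ≈ 1#
    _≟_      : Decidable _≈_
    enum     : Fin N → Carrier
    enum-inj : ∀ i j → enum i ≈ enum j → i ≡ j
    enum-sur : ∀ x → ∃ λ i → enum i ≈ x
    ω        : Carrier
    ω-gen    : ∀ x → ¬ (x ≈ 0#) → ∃ λ i → x ≈ pow fieldRing ω i

  ord : ℕ
  ord = N ∸ 1

  -- x ∈ C_a := ω^a ⟨ω^e⟩ ; since ω^e has order dividing N-1, ⟨ω^e⟩ = {ω^(e j) | j < N-1}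
  InCoset : (e a : ℕ) → Carrier → Set ℓ
  InCoset e a x = ∃ λ (j : Fin ord) → x ≈ pow fieldRing ω (a ℕ.+ e ℕ.* toℕ j)

  inCoset? : (e a : ℕ) (x : Carrier) → Dec (InCoset e a x)
  inCoset? e a x = any? (λ j → x ≟ pow fieldRing ω (a ℕ.+ e ℕ.* toℕ j))

  cyclotomic : (e a b : ℕ) → ℕ
  cyclotomic e a b =
    length (filter (λ i → inCoset? e a (enum i) ×-dec inCoset? e b (enum i + 1#)) (allFin N))

isEven : ℕ → Bool
isEven n = n % 2 ≡ᵇ 0

A-term : (q r a : ℕ) → ℤ
A-term q r a =
  if (isEven r ∧ (a ≡ᵇ 0))
     ∨ (not (isEven r) ∧ isEven q ∧ (a ≡ᵇ 0))
     ∨ (not (isEven r) ∧ not (isEven q) ∧ (2 ℕ.* a ≡ᵇ q ∸ 1))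
  then ℤ.- (+ (q ∸ 2)) else + 1

B-term : (q b : ℕ) → ℤ
B-term q b = if b ≡ᵇ 0 then ℤ.- (+ (q ∸ 2)) else + 1

C-term : (q a b : ℕ) → ℤ
C-term q a b = if a ≡ᵇ b then ℤ.- (+ (q ∸ 2)) else + 1

M-numerator : (q r a b : ℕ) → ℤ
M-numerator q r a b = (+ (q ℕ.^ r) ℤ.- + 2) ℤ.+ A-term q r a ℤ.+ B-term q b ℤ.+ C-term q a b

module Submission where

-- Write κ x = log_ω x mod e for the class of x ≠ 0 (e = q - 1, k = (q^r - 1)/e), and c a b for the
-- cyclotomic numbers.  The e × e matrix c has known sums along rows, columns and the "diagonals"
-- a - b = d: each is k minus a correction coming from 0, 1 and -1, because x ↦ x + 1 and x ↦ x/(x + 1)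
-- are bijections away from one point.  Its sum of squares counts pairs (x , y) in the same class with
-- x + 1, y + 1 in the same class; substituting y = t x and then the Möbius map x ↦ (t x + 1)/(x + 1)
-- evaluates it as (q^r - 2) + (k - 1)(k - 2).  Hence the deviation D = e² c - (numerator of M) has
-- vanishing line sums and ∑ D² = e² (e - 1)(e - 2) q^r.  On the space of such matrices the point
-- evaluation D ↦ D a b is represented by a kernel of squared norm (e - 1)(e - 2)/e², so Cauchy–Schwarz
-- gives D a b ² ≤ (e - 1)² (e - 2)² q^r, with no characters or Jacobi sums.  The case distinction in
-- A_r(a) is the computation of the class of -1, which is ω^(L/2) when L = q^r - 1 is even.

open import Level using (Level)
open import Function using (_∘_; _⇔_; mk⇔; Equivalence)
open import Data.Empty using (⊥-elim)
open import Data.Product using (∃; _×_; _,_; proj₁; proj₂)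
open import Data.Sum using (_⊎_; inj₁; inj₂; [_,_]′)
open import Data.Bool using (Bool; true; false; not; _∧_; _∨_; if_then_else_)
import Data.Bool.Properties as Boolₚ
open import Data.Maybe using (Maybe; just; nothing)
open import Data.List using (length; filter; tabulate)
open import Relation.Nullary using (Dec; yes; no; ¬_; ¬?; does)
open import Relation.Nullary.Decidable using (_×-dec_)
open import Relation.Unary using (Pred; Decidable)
open import Relation.Binary using (_Preserves_⟶_; tri<; tri≈; tri>)
open import Relation.Binary.PropositionalEquality as ≡ using (_≡_; _≢_)
import Relation.Binary.Reasoning.Setoid
open import Data.Nat as ℕ using (ℕ; zero; suc; NonZero; _≤_; _∸_; _^_; _%_; _/_; _≡ᵇ_; s≤s; z≤n)
import Data.Nat.Properties as ℕₚ
open import Data.Nat.DivMod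
  using (_mod_; %-distribˡ-+; %-distribˡ-*; %-pred-≡0; m%n%n≡m%n; [m+n]%n≡m%n; [m+kn]%n≡m%n; m<n⇒m%n≡m;
         m%n<n; m≡m%n+[m/n]*n; m<n*o⇒m/o<n; m∣n⇒o%n%m≡o%m; m/n≤m; m*n%n≡0)
open import Data.Nat.Divisibility using (divides)
open import Data.Nat.Primality using (Prime; prime⇒nonTrivial)
import Data.Nat.Tactic.RingSolver as NSolver
open import Data.Integer as ℤ using (ℤ; +_; -[1+_]; +[1+_]; 0ℤ; 1ℤ; +≤+; +<+)
import Data.Integer.Properties as ℤₚ
import Data.Integer.Tactic.RingSolver as ZSolver
open import Data.Fin as Fin using (Fin; toℕ; _↑ˡ_; _↑ʳ_)
import Data.Fin.Properties as Finₚ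
open import Algebra.Bundles using (CommutativeRing)
open import Algebra.Properties.Semiring.Sum ℤₚ.+-*-semiring
  using (sum; sum-syntax; sum-cong-≗; *-distribˡ-sum; *-distribʳ-sum; ∑-distrib-+; ∑-comm)
import Algebra.Solver.Ring
open import Algebra.Solver.Ring.AlmostCommutativeRing using (fromCommutativeRing; _-Raw-AlmostCommutative⟶_)
import Algebra.Properties.Ring
import Algebra.Properties.Group
import Algebra.Properties.AbelianGroup
import Algebra.Properties.CommutativeSemigroup
import Algebra.Properties.Monoid.Mult.TCOptimised
import Algebra.Properties.Semiring.Mult.TCOptimised
open import Defs

private
  variable
    a b : Level
    A B : Set a
    n : ℕ

-- Indicators and finite sums

𝟙 : Dec A → ℤ
𝟙 (yes _) = 1ℤ
𝟙 (no _)  = 0ℤ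

𝟙-yes : A → {d : Dec A} → 𝟙 d ≡ 1ℤ
𝟙-yes x {yes _} = ≡.refl
𝟙-yes x {no ¬x} = ⊥-elim (¬x x)

𝟙-no : ¬ A → {d : Dec A} → 𝟙 d ≡ 0ℤ
𝟙-no ¬x {yes x} = ⊥-elim (¬x x)
𝟙-no ¬x {no _}  = ≡.refl

𝟙-cong : A ⇔ B → {d : Dec A} {d′ : Dec B} → 𝟙 d ≡ 𝟙 d′
𝟙-cong A⇔B {yes x} = ≡.sym (𝟙-yes (Equivalence.to A⇔B x))
𝟙-cong A⇔B {no ¬x} = ≡.sym (𝟙-no (¬x ∘ Equivalence.from A⇔B))

𝟙-× : (d : Dec A) (d′ : Dec B) → 𝟙 (d ×-dec d′) ≡ 𝟙 d ℤ.* 𝟙 d′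
𝟙-× (yes _) (yes _) = ≡.refl
𝟙-× (yes _) (no _)  = ≡.refl
𝟙-× (no _)  _       = ≡.refl

𝟙-¬ : (d : Dec A) → 𝟙 (¬? d) ≡ 1ℤ ℤ.- 𝟙 d
𝟙-¬ (yes _) = ≡.refl
𝟙-¬ (no _)  = ≡.refl

δ : Fin n → Fin n → ℤ
δ i j = 𝟙 (i Fin.≟ j)

δ-refl : (i : Fin n) → δ i i ≡ 1ℤ
δ-refl i = 𝟙-yes ≡.refl

δ-sym : (i j : Fin n) → δ i j ≡ δ j i
δ-sym i j = 𝟙-cong (mk⇔ ≡.sym ≡.sym)

∑-const : ∀ n (c : ℤ) → ∑[ i < n ] c ≡ + n ℤ.* c
∑-const zero    c = ≡.sym (ℤₚ.*-zeroˡ c)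
∑-const (suc n) c = begin
  c ℤ.+ ∑[ i < n ] c    ≡⟨ ≡.cong (ℤ._+_ c) (∑-const n c) ⟩
  c ℤ.+ + n ℤ.* c       ≡⟨ ≡.cong (ℤ._+ + n ℤ.* c) (≡.sym (ℤₚ.*-identityˡ c)) ⟩
  1ℤ ℤ.* c ℤ.+ + n ℤ.* c ≡⟨ ≡.sym (ℤₚ.*-distribʳ-+ c 1ℤ (+ n)) ⟩
  + suc n ℤ.* c         ∎
  where open ≡.≡-Reasoning

∑-*ˡ : ∀ n (c : ℤ) (f : Fin n → ℤ) → ∑[ i < n ] (c ℤ.* f i) ≡ c ℤ.* ∑[ i < n ] f i
∑-*ˡ n c f = ≡.sym (*-distribˡ-sum c f)

∑-+-* : ∀ n (f : Fin n → ℤ) (c : ℤ) (g : Fin n → ℤ) →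
        ∑[ i < n ] (f i ℤ.+ c ℤ.* g i) ≡ ∑[ i < n ] f i ℤ.+ c ℤ.* ∑[ i < n ] g i
∑-+-* n f c g = ≡.trans (∑-distrib-+ f (λ i → c ℤ.* g i)) (≡.cong (ℤ._+_ (∑[ i < n ] f i)) (∑-*ˡ n c g))

∑-*ʳ : ∀ n (c : ℤ) (f : Fin n → ℤ) → ∑[ i < n ] (f i ℤ.* c) ≡ ∑[ i < n ] f i ℤ.* c
∑-*ʳ n c f = ≡.sym (*-distribʳ-sum c f)

∑-*-+ : ∀ n (c : ℤ) (f g : Fin n → ℤ) →
        ∑[ i < n ] (c ℤ.* f i ℤ.+ g i) ≡ c ℤ.* ∑[ i < n ] f i ℤ.+ ∑[ i < n ] g i
∑-*-+ n c f g = ≡.trans (∑-distrib-+ (λ i → c ℤ.* f i) g) (≡.cong (ℤ._+ ∑[ i < n ] g i) (∑-*ˡ n c f))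

∑-δˡ : (j : Fin n) (f : Fin n → ℤ) → ∑[ i < n ] (δ i j ℤ.* f i) ≡ f j
∑-δˡ {suc n} Fin.zero f = begin
  1ℤ ℤ.* f Fin.zero ℤ.+ ∑[ i < n ] (δ (Fin.suc i) Fin.zero ℤ.* f (Fin.suc i))
    ≡⟨ ≡.cong₂ ℤ._+_ (ℤₚ.*-identityˡ (f Fin.zero)) (sum-cong-≗ (λ i → ℤₚ.*-zeroˡ (f (Fin.suc i)))) ⟩
  f Fin.zero ℤ.+ ∑[ i < n ] 0ℤ
    ≡⟨ ≡.cong (ℤ._+_ (f Fin.zero)) (≡.trans (∑-const n 0ℤ) (ℤₚ.*-zeroʳ (+ n))) ⟩
  f Fin.zero ℤ.+ 0ℤ
    ≡⟨ ℤₚ.+-identityʳ _ ⟩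
  f Fin.zero ∎
  where open ≡.≡-Reasoning
∑-δˡ {suc n} (Fin.suc j) f = begin
  0ℤ ℤ.* f Fin.zero ℤ.+ ∑[ i < n ] (δ (Fin.suc i) (Fin.suc j) ℤ.* f (Fin.suc i))
    ≡⟨ ≡.cong₂ ℤ._+_ (ℤₚ.*-zeroˡ (f Fin.zero))
         (sum-cong-≗ (λ i → ≡.cong (ℤ._* f (Fin.suc i)) (𝟙-cong (mk⇔ Finₚ.suc-injective (≡.cong Fin.suc)) {Fin.suc i Fin.≟ Fin.suc j} {i Fin.≟ j}))) ⟩
  0ℤ ℤ.+ ∑[ i < n ] (δ i j ℤ.* f (Fin.suc i))
    ≡⟨ ≡.trans (ℤₚ.+-identityˡ (∑[ i < n ] (δ i j ℤ.* f (Fin.suc i)))) (∑-δˡ j (f ∘ Fin.suc)) ⟩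
  f (Fin.suc j) ∎
  where open ≡.≡-Reasoning

∑-δ : (j : Fin n) → ∑[ i < n ] δ i j ≡ 1ℤ
∑-δ j = ≡.trans (sum-cong-≗ (λ i → ≡.sym (ℤₚ.*-identityʳ (δ i j)))) (∑-δˡ j (λ _ → 1ℤ))

square-nonneg : ∀ x → 0ℤ ℤ.≤ x ℤ.* x
square-nonneg (+ zero)  = +≤+ z≤n
square-nonneg (+ suc n) = +≤+ z≤n
square-nonneg -[1+ n ]  = +≤+ z≤n

square≡0 : ∀ x → x ℤ.* x ≡ 0ℤ → x ≡ 0ℤ
square≡0 x x²≡0 with ℤₚ.i*j≡0⇒i≡0∨j≡0 x x²≡0
... | inj₁ x≡0 = x≡0
... | inj₂ x≡0 = x≡0

∑-nonneg : ∀ {n} (f : Fin n → ℤ) → (∀ i → 0ℤ ℤ.≤ f i) → 0ℤ ℤ.≤ ∑[ i < n ] f i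
∑-nonneg {zero}  f f≥0 = ℤₚ.≤-refl
∑-nonneg {suc n} f f≥0 = ℤₚ.+-mono-≤ (f≥0 Fin.zero) (∑-nonneg (f ∘ Fin.suc) (f≥0 ∘ Fin.suc))

private
  nonneg-sum≡0 : ∀ {x y} → 0ℤ ℤ.≤ x → 0ℤ ℤ.≤ y → x ℤ.+ y ≡ 0ℤ → x ≡ 0ℤ × y ≡ 0ℤ
  nonneg-sum≡0 {+ m} {+ n} _ _ x+y≡0 =
    ≡.cong +_ (ℕₚ.m+n≡0⇒m≡0 m (ℤₚ.+-injective x+y≡0)) , ≡.cong +_ (ℕₚ.m+n≡0⇒n≡0 m (ℤₚ.+-injective x+y≡0))

∑-nonneg-≡0 : ∀ {n} (f : Fin n → ℤ) → (∀ i → 0ℤ ℤ.≤ f i) → ∑[ i < n ] f i ≡ 0ℤ → ∀ i → f i ≡ 0ℤ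
∑-nonneg-≡0 {suc n} f f≥0 ∑f≡0 Fin.zero    = proj₁ (nonneg-sum≡0 (f≥0 Fin.zero) (∑-nonneg (f ∘ Fin.suc) (f≥0 ∘ Fin.suc)) ∑f≡0)
∑-nonneg-≡0 {suc n} f f≥0 ∑f≡0 (Fin.suc i) =
  ∑-nonneg-≡0 (f ∘ Fin.suc) (f≥0 ∘ Fin.suc)
    (proj₂ (nonneg-sum≡0 (f≥0 Fin.zero) (∑-nonneg (f ∘ Fin.suc) (f≥0 ∘ Fin.suc)) ∑f≡0)) i

∑-product : ∀ {m n} (f : Fin m → ℤ) (g : Fin n → ℤ) →
            ∑[ i < m ] f i ℤ.* ∑[ j < n ] g j ≡ ∑[ i < m ] ∑[ j < n ] (f i ℤ.* g j)
∑-product {m} {n} f g = ≡.trans (≡.sym (∑-*ʳ m (∑[ j < n ] g j) f)) (sum-cong-≗ (λ i → ≡.sym (∑-*ˡ n (f i) g)))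

∑-pull-inside : ∀ {m n p} (f : Fin m → Fin n → Fin p → ℤ) →
                ∑[ a < m ] ∑[ x < n ] ∑[ y < p ] f a x y ≡ ∑[ x < n ] ∑[ y < p ] ∑[ a < m ] f a x y
∑-pull-inside f = ≡.trans (∑-comm (λ a x → ∑[ y < _ ] f a x y)) (sum-cong-≗ (λ x → ∑-comm (λ a y → f a x y)))

∑∑-square : ∀ {m n p} (u : Fin m → Fin p → ℤ) (v : Fin n → Fin p → ℤ) →
            ∑[ a < m ] ∑[ b < n ] (∑[ x < p ] (u a x ℤ.* v b x) ℤ.* ∑[ y < p ] (u a y ℤ.* v b y))
            ≡ ∑[ x < p ] ∑[ y < p ] (∑[ a < m ] (u a x ℤ.* u a y) ℤ.* ∑[ b < n ] (v b x ℤ.* v b y))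
∑∑-square {m} {n} {p} u v = begin
  ∑[ a < m ] ∑[ b < n ] (∑[ x < p ] (u a x ℤ.* v b x) ℤ.* ∑[ y < p ] (u a y ℤ.* v b y))
    ≡⟨ sum-cong-≗ (λ a → sum-cong-≗ (λ b → ∑-product (λ x → u a x ℤ.* v b x) (λ y → u a y ℤ.* v b y))) ⟩
  ∑[ a < m ] ∑[ b < n ] ∑[ x < p ] ∑[ y < p ] (u a x ℤ.* v b x ℤ.* (u a y ℤ.* v b y))
    ≡⟨ sum-cong-≗ (λ a → ∑-pull-inside (λ b x y → u a x ℤ.* v b x ℤ.* (u a y ℤ.* v b y))) ⟩
  ∑[ a < m ] ∑[ x < p ] ∑[ y < p ] ∑[ b < n ] (u a x ℤ.* v b x ℤ.* (u a y ℤ.* v b y))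
    ≡⟨ ∑-pull-inside (λ a x y → ∑[ b < n ] (u a x ℤ.* v b x ℤ.* (u a y ℤ.* v b y))) ⟩
  ∑[ x < p ] ∑[ y < p ] ∑[ a < m ] ∑[ b < n ] (u a x ℤ.* v b x ℤ.* (u a y ℤ.* v b y))
    ≡⟨ sum-cong-≗ (λ x → sum-cong-≗ (λ y → ≡.trans
         (sum-cong-≗ (λ a → sum-cong-≗ (λ b → regroup (u a x) (v b x) (u a y) (v b y))))
         (≡.sym (∑-product (λ a → u a x ℤ.* u a y) (λ b → v b x ℤ.* v b y))))) ⟩
  ∑[ x < p ] ∑[ y < p ] (∑[ a < m ] (u a x ℤ.* u a y) ℤ.* ∑[ b < n ] (v b x ℤ.* v b y)) ∎
  where
  open ≡.≡-Reasoning
  regroup : ∀ p q r s → p ℤ.* q ℤ.* (r ℤ.* s) ≡ p ℤ.* r ℤ.* (q ℤ.* s)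
  regroup = ZSolver.solve-∀

∑-split : ∀ m n (f : Fin (m ℕ.+ n) → ℤ) →
          ∑[ i < m ℕ.+ n ] f i ≡ ∑[ i < m ] f (i ↑ˡ n) ℤ.+ ∑[ j < n ] f (m ↑ʳ j)
∑-split zero    n f = ≡.sym (ℤₚ.+-identityˡ _)
∑-split (suc m) n f = ≡.trans (≡.cong (ℤ._+_ (f Fin.zero)) (∑-split m n (f ∘ Fin.suc)))
                            (≡.sym (ℤₚ.+-assoc (f Fin.zero) _ _))

length-filter : ∀ {p} {P : Pred A p} (P? : Decidable P) (g : Fin n → A) →
                + length (filter P? (tabulate g)) ≡ ∑[ i < n ] 𝟙 (P? (g i))
length-filter {n = zero}  P? g = ≡.refl
length-filter {n = suc n} P? g with P? (g Fin.zero)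
... | yes _ = ≡.trans (ℤₚ.pos-+ 1 _) (≡.cong (ℤ._+_ 1ℤ) (length-filter P? (g ∘ Fin.suc)))
... | no _  = ≡.trans (length-filter P? (g ∘ Fin.suc)) (≡.sym (ℤₚ.+-identityˡ _))

double≢odd : ∀ m n → m ℕ.+ m ≢ suc (n ℕ.+ n)
double≢odd zero    zero    ()
double≢odd zero    (suc n) ()
double≢odd (suc m) zero    eq with ≡.trans (≡.sym (ℕₚ.+-suc m m)) (ℕₚ.suc-injective eq)
... | ()
double≢odd (suc m) (suc n) eq = double≢odd m n (ℕₚ.suc-injective
  (≡.trans (≡.sym (ℕₚ.+-suc m m)) (≡.trans (ℕₚ.suc-injective eq) (≡.cong suc (ℕₚ.+-suc n n)))))

multiple<double : ∀ {m n} ⦃ _ : NonZero n ⦄ → m % n ≡ 0 → m ℕ.< n ℕ.+ n → m ≡ 0 ⊎ m ≡ n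
multiple<double {m} {n} m%n≡0 m<2n with m / n | m≡m%n+[m/n]*n m n | m<n*o⇒m/o<n {m} {2} {n} (≡.subst (m ℕ.<_) (≡.cong (n ℕ.+_) (≡.sym (ℕₚ.+-identityʳ n))) m<2n)
... | zero        | m≡ | _ = inj₁ (≡.trans m≡ (≡.cong (ℕ._+ 0) m%n≡0))
... | suc zero    | m≡ | _ = inj₂ (≡.trans m≡ (≡.trans (≡.cong (ℕ._+ (n ℕ.+ 0)) m%n≡0) (ℕₚ.+-identityʳ n)))
... | suc (suc _) | _  | ℕ.s≤s (ℕ.s≤s ())

module Cyclic (e : ℕ) ⦃ _ : NonZero e ⦄ where

  infixl 6 _⊕_ _⊖_

  𝟘 : Fin e
  𝟘 = 0 mod e

  _⊕_ _⊖_ : Fin e → Fin e → Fin e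
  i ⊕ j = (toℕ i ℕ.+ toℕ j) mod e
  i ⊖ j = (toℕ i ℕ.+ (e ∸ toℕ j)) mod e

  toℕ-mod : ∀ m → toℕ (m mod e) ≡ m % e
  toℕ-mod m = Finₚ.toℕ-fromℕ< (m%n<n m e)

  private
    [m%e+n]%e≡[m+n]%e : ∀ m n → (m % e ℕ.+ n) % e ≡ (m ℕ.+ n) % e
    [m%e+n]%e≡[m+n]%e m n = begin
      (m % e ℕ.+ n) % e           ≡⟨ %-distribˡ-+ (m % e) n e ⟩
      (m % e % e ℕ.+ n % e) % e   ≡⟨ ≡.cong (λ x → (x ℕ.+ n % e) % e) (m%n%n≡m%n m e) ⟩
      (m % e ℕ.+ n % e) % e       ≡⟨ ≡.sym (%-distribˡ-+ m n e) ⟩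
      (m ℕ.+ n) % e               ∎
      where open ≡.≡-Reasoning

    shift-back : ∀ (i : Fin e) u v → u ℕ.+ v ≡ e → ((toℕ i ℕ.+ u) % e ℕ.+ v) % e ≡ toℕ i
    shift-back i u v u+v≡e = begin
      ((toℕ i ℕ.+ u) % e ℕ.+ v) % e ≡⟨ [m%e+n]%e≡[m+n]%e (toℕ i ℕ.+ u) v ⟩
      (toℕ i ℕ.+ u ℕ.+ v) % e       ≡⟨ ≡.cong (_% e) (≡.trans (ℕₚ.+-assoc (toℕ i) u v) (≡.cong (toℕ i ℕ.+_) u+v≡e)) ⟩
      (toℕ i ℕ.+ e) % e             ≡⟨ [m+n]%n≡m%n (toℕ i) e ⟩
      toℕ i % e                     ≡⟨ m<n⇒m%n≡m (Finₚ.toℕ<n i) ⟩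
      toℕ i                         ∎
      where open ≡.≡-Reasoning

  ⊕-comm : ∀ i j → i ⊕ j ≡ j ⊕ i
  ⊕-comm i j = ≡.cong (_mod e) (ℕₚ.+-comm (toℕ i) (toℕ j))

  toℕ-𝟘 : toℕ 𝟘 ≡ 0
  toℕ-𝟘 = ≡.trans (toℕ-mod 0) (m<n⇒m%n≡m (ℕ.>-nonZero⁻¹ e))

  toℕ-⊕ : ∀ i j → toℕ (i ⊕ j) ≡ (toℕ i ℕ.+ toℕ j) % e
  toℕ-⊕ i j = toℕ-mod (toℕ i ℕ.+ toℕ j)

  ⊕-identityʳ : ∀ i → i ⊕ 𝟘 ≡ i
  ⊕-identityʳ i = Finₚ.toℕ-injective (begin
    toℕ (i ⊕ 𝟘)           ≡⟨ toℕ-⊕ i 𝟘 ⟩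
    (toℕ i ℕ.+ toℕ 𝟘) % e ≡⟨ ≡.cong (λ x → (toℕ i ℕ.+ x) % e) toℕ-𝟘 ⟩
    (toℕ i ℕ.+ 0) % e     ≡⟨ ≡.cong (_% e) (ℕₚ.+-identityʳ (toℕ i)) ⟩
    toℕ i % e             ≡⟨ m<n⇒m%n≡m (Finₚ.toℕ<n i) ⟩
    toℕ i                 ∎)
    where open ≡.≡-Reasoning

  ⊕-identityˡ : ∀ i → 𝟘 ⊕ i ≡ i
  ⊕-identityˡ i = ≡.trans (⊕-comm 𝟘 i) (⊕-identityʳ i)

  ⊖-⊕ : ∀ i j → (i ⊖ j) ⊕ j ≡ i
  ⊖-⊕ i j = Finₚ.toℕ-injective (begin
    toℕ ((i ⊖ j) ⊕ j)                          ≡⟨ toℕ-⊕ (i ⊖ j) j ⟩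
    (toℕ (i ⊖ j) ℕ.+ toℕ j) % e                ≡⟨ ≡.cong (λ x → (x ℕ.+ toℕ j) % e) (toℕ-mod _) ⟩
    ((toℕ i ℕ.+ (e ∸ toℕ j)) % e ℕ.+ toℕ j) % e ≡⟨ shift-back i (e ∸ toℕ j) (toℕ j) (ℕₚ.m∸n+n≡m (Finₚ.toℕ≤n j)) ⟩
    toℕ i                                      ∎)
    where open ≡.≡-Reasoning

  ⊕-⊖ : ∀ i j → (i ⊕ j) ⊖ j ≡ i
  ⊕-⊖ i j = Finₚ.toℕ-injective (begin
    toℕ ((i ⊕ j) ⊖ j)                          ≡⟨ toℕ-mod _ ⟩
    (toℕ (i ⊕ j) ℕ.+ (e ∸ toℕ j)) % e          ≡⟨ ≡.cong (λ x → (x ℕ.+ (e ∸ toℕ j)) % e) (toℕ-⊕ i j) ⟩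
    ((toℕ i ℕ.+ toℕ j) % e ℕ.+ (e ∸ toℕ j)) % e ≡⟨ shift-back i (toℕ j) (e ∸ toℕ j) (ℕₚ.m+[n∸m]≡n (Finₚ.toℕ≤n j)) ⟩
    toℕ i                                      ∎)
    where open ≡.≡-Reasoning

  ⊕-cancelʳ : ∀ {i j} k → i ⊕ k ≡ j ⊕ k → i ≡ j
  ⊕-cancelʳ {i} {j} k eq = ≡.trans (≡.sym (⊕-⊖ i k)) (≡.trans (≡.cong (_⊖ k) eq) (⊕-⊖ j k))

  ⊕≡⇔≡⊖ : ∀ {i j k} → (i ⊕ j ≡ k) ⇔ (i ≡ k ⊖ j)
  ⊕≡⇔≡⊖ {i} {j} {k} = mk⇔ (λ eq → ⊕-cancelʳ j (≡.trans eq (≡.sym (⊖-⊕ k j))))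
                            (λ eq → ≡.trans (≡.cong (_⊕ j) eq) (⊖-⊕ k j))

  toℕ-mod-toℕ : ∀ (i : Fin e) → toℕ i mod e ≡ i
  toℕ-mod-toℕ i = Finₚ.toℕ-injective (≡.trans (toℕ-mod (toℕ i)) (m<n⇒m%n≡m (Finₚ.toℕ<n i)))

  ∑-δ-mod : ∀ k (a : Fin e) → ∑[ i < k ℕ.* e ] δ (toℕ i mod e) a ≡ + k
  ∑-δ-mod zero    a = ≡.refl
  ∑-δ-mod (suc k) a = begin
    ∑[ i < e ℕ.+ k ℕ.* e ] δ (toℕ i mod e) a
      ≡⟨ ∑-split e (k ℕ.* e) (λ i → δ (toℕ i mod e) a) ⟩
    ∑[ i < e ] δ (toℕ (i ↑ˡ k ℕ.* e) mod e) a ℤ.+ ∑[ j < k ℕ.* e ] δ (toℕ (e ↑ʳ j) mod e) a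
      ≡⟨ ≡.cong₂ ℤ._+_ (≡.trans (sum-cong-≗ {e} (λ i → ≡.cong (λ r → δ (r mod e) a) (Finₚ.toℕ-↑ˡ i (k ℕ.* e)))) first-period)
                     (sum-cong-≗ {k ℕ.* e} (λ j → ≡.cong (λ r → δ r a) (shift j))) ⟩
    1ℤ ℤ.+ ∑[ j < k ℕ.* e ] δ (toℕ j mod e) a
      ≡⟨ ≡.cong (ℤ._+_ 1ℤ) (∑-δ-mod k a) ⟩
    1ℤ ℤ.+ + k
      ≡⟨ ≡.sym (ℤₚ.pos-+ 1 k) ⟩
    + suc k ∎
    where
    open ≡.≡-Reasoning
    first-period : ∑[ i < e ] δ (toℕ i mod e) a ≡ 1ℤ
    first-period = ≡.trans (sum-cong-≗ (λ i → ≡.cong (λ r → δ r a) (toℕ-mod-toℕ i))) (∑-δ a)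
    shift : ∀ (j : Fin (k ℕ.* e)) → toℕ (e ↑ʳ j) mod e ≡ toℕ j mod e
    shift j = Finₚ.toℕ-injective (begin
      toℕ (toℕ (e ↑ʳ j) mod e) ≡⟨ toℕ-mod _ ⟩
      toℕ (e ↑ʳ j) % e         ≡⟨ ≡.cong (_% e) (≡.trans (Finₚ.toℕ-↑ʳ e j) (ℕₚ.+-comm e (toℕ j))) ⟩
      (toℕ j ℕ.+ e) % e        ≡⟨ [m+n]%n≡m%n (toℕ j) e ⟩
      toℕ j % e                ≡⟨ ≡.sym (toℕ-mod (toℕ j)) ⟩
      toℕ (toℕ j mod e)        ∎)

-- Arrays on (ℤ/eℤ)² with vanishing line sums

module LineSums (e : ℕ) ⦃ _ : NonZero e ⦄ where
  open Cyclic e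
  open import Data.Integer using (_+_; _*_; -_; _-_)
  open ≡.≡-Reasoning

  E : ℤ
  E = + e

  instance
    E-positive : ℤ.Positive E
    E-positive = ℤ.positive (+<+ (ℕ.>-nonZero⁻¹ e))

  Array : Set
  Array = Fin e → Fin e → ℤ

  rowSum colSum diagSum : Array → Fin e → ℤ
  rowSum  g a = ∑[ j < e ] g a j
  colSum  g b = ∑[ i < e ] g i b
  diagSum g d = ∑[ j < e ] g (j ⊕ d) j

  total : Array → ℤ
  total g = ∑[ i < e ] rowSum g i

  ⟨_,_⟩ : Array → Array → ℤ
  ⟨ u , v ⟩ = ∑[ i < e ] ∑[ j < e ] (u i j * v i j)

  record VanishingLineSums (g : Array) : Set where
    field
      rows  : ∀ a → rowSum g a ≡ 0ℤ
      cols  : ∀ b → colSum g b ≡ 0ℤ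
      diags : ∀ d → diagSum g d ≡ 0ℤ

  point : Fin e → Fin e → Array
  point a b i j = δ i a * δ j b

  line : (α β γ ε : ℤ) (a b d : Fin e) → Array
  line α β γ ε a b d i j = α + β * δ i a + γ * δ j b + ε * δ i (j ⊕ d)

  δ-⊕ : ∀ i j d → δ i (j ⊕ d) ≡ δ j (i ⊖ d)
  δ-⊕ i j d = 𝟙-cong (mk⇔ (λ eq → Equivalence.to ⊕≡⇔≡⊖ (≡.sym eq)) (λ eq → ≡.sym (Equivalence.from ⊕≡⇔≡⊖ eq)))

  δ-⊕-cancel : ∀ j d′ d → δ (j ⊕ d′) (j ⊕ d) ≡ δ d′ d
  δ-⊕-cancel j d′ d = 𝟙-cong (mk⇔ (λ eq → ⊕-cancelʳ j (≡.trans (⊕-comm d′ j) (≡.trans eq (⊕-comm j d))))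
                                   (≡.cong (j ⊕_)))

  ∑-δ-⊕ : ∀ i d → ∑[ j < e ] δ i (j ⊕ d) ≡ 1ℤ
  ∑-δ-⊕ i d = ≡.trans (sum-cong-≗ (λ j → δ-⊕ i j d)) (∑-δ (i ⊖ d))

  ∑-line : ∀ α β γ ε (x y z : Fin e → ℤ) →
           ∑[ j < e ] (α + β * x j + γ * y j + ε * z j)
           ≡ E * α + β * ∑[ j < e ] x j + γ * ∑[ j < e ] y j + ε * ∑[ j < e ] z j
  ∑-line α β γ ε x y z = begin
    ∑[ j < e ] (α + β * x j + γ * y j + ε * z j)
      ≡⟨ ∑-+-* e _ ε z ⟩
    ∑[ j < e ] (α + β * x j + γ * y j) + ε * ∑[ j < e ] z j
      ≡⟨ ≡.cong (_+ ε * ∑[ j < e ] z j) (∑-+-* e _ γ y) ⟩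
    ∑[ j < e ] (α + β * x j) + γ * ∑[ j < e ] y j + ε * ∑[ j < e ] z j
      ≡⟨ ≡.cong (λ t → t + γ * ∑[ j < e ] y j + ε * ∑[ j < e ] z j)
              (≡.trans (∑-+-* e _ β x) (≡.cong (_+ β * ∑[ j < e ] x j) (∑-const e α))) ⟩
    E * α + β * ∑[ j < e ] x j + γ * ∑[ j < e ] y j + ε * ∑[ j < e ] z j ∎

  rowSum-line : ∀ α β γ ε a b d i →
                rowSum (line α β γ ε a b d) i ≡ E * α + β * (E * δ i a) + γ * 1ℤ + ε * 1ℤ
  rowSum-line α β γ ε a b d i = begin
    rowSum (line α β γ ε a b d) i
      ≡⟨ ∑-line α β γ ε (λ _ → δ i a) (λ j → δ j b) (λ j → δ i (j ⊕ d)) ⟩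
    E * α + β * ∑[ j < e ] δ i a + γ * ∑[ j < e ] δ j b + ε * ∑[ j < e ] δ i (j ⊕ d)
      ≡⟨ ≡.cong₂ (λ s t → E * α + β * s + γ * t + ε * ∑[ j < e ] δ i (j ⊕ d)) (∑-const e (δ i a)) (∑-δ b) ⟩
    E * α + β * (E * δ i a) + γ * 1ℤ + ε * ∑[ j < e ] δ i (j ⊕ d)
      ≡⟨ ≡.cong (λ t → E * α + β * (E * δ i a) + γ * 1ℤ + ε * t) (∑-δ-⊕ i d) ⟩
    E * α + β * (E * δ i a) + γ * 1ℤ + ε * 1ℤ ∎

  colSum-line : ∀ α β γ ε a b d j →
                colSum (line α β γ ε a b d) j ≡ E * α + β * 1ℤ + γ * (E * δ j b) + ε * 1ℤ
  colSum-line α β γ ε a b d j = begin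
    colSum (line α β γ ε a b d) j
      ≡⟨ ∑-line α β γ ε (λ i → δ i a) (λ _ → δ j b) (λ i → δ i (j ⊕ d)) ⟩
    E * α + β * ∑[ i < e ] δ i a + γ * ∑[ i < e ] δ j b + ε * ∑[ i < e ] δ i (j ⊕ d)
      ≡⟨ ≡.cong₂ (λ s t → E * α + β * s + γ * t + ε * ∑[ i < e ] δ i (j ⊕ d)) (∑-δ a) (∑-const e (δ j b)) ⟩
    E * α + β * 1ℤ + γ * (E * δ j b) + ε * ∑[ i < e ] δ i (j ⊕ d)
      ≡⟨ ≡.cong (λ t → E * α + β * 1ℤ + γ * (E * δ j b) + ε * t) (∑-δ (j ⊕ d)) ⟩
    E * α + β * 1ℤ + γ * (E * δ j b) + ε * 1ℤ ∎

  diagSum-line : ∀ α β γ ε a b d d′ →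
                 diagSum (line α β γ ε a b d) d′ ≡ E * α + β * 1ℤ + γ * 1ℤ + ε * (E * δ d′ d)
  diagSum-line α β γ ε a b d d′ = begin
    diagSum (line α β γ ε a b d) d′
      ≡⟨ ∑-line α β γ ε (λ j → δ (j ⊕ d′) a) (λ j → δ j b) (λ j → δ (j ⊕ d′) (j ⊕ d)) ⟩
    E * α + β * ∑[ j < e ] δ (j ⊕ d′) a + γ * ∑[ j < e ] δ j b + ε * ∑[ j < e ] δ (j ⊕ d′) (j ⊕ d)
      ≡⟨ ≡.cong₂ (λ s t → E * α + β * s + γ * t + ε * ∑[ j < e ] δ (j ⊕ d′) (j ⊕ d))
               (≡.trans (sum-cong-≗ (λ j → δ-sym (j ⊕ d′) a)) (∑-δ-⊕ a d′)) (∑-δ b) ⟩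
    E * α + β * 1ℤ + γ * 1ℤ + ε * ∑[ j < e ] δ (j ⊕ d′) (j ⊕ d)
      ≡⟨ ≡.cong (λ t → E * α + β * 1ℤ + γ * 1ℤ + ε * t)
              (≡.trans (sum-cong-≗ (λ j → δ-⊕-cancel j d′ d)) (∑-const e (δ d′ d))) ⟩
    E * α + β * 1ℤ + γ * 1ℤ + ε * (E * δ d′ d) ∎

  rowSum-point : ∀ a b i → rowSum (point a b) i ≡ δ i a
  rowSum-point a b i = ≡.trans (∑-*ˡ e (δ i a) (λ j → δ j b)) (≡.trans (≡.cong (δ i a *_) (∑-δ b)) (ℤₚ.*-identityʳ (δ i a)))

  colSum-point : ∀ a b j → colSum (point a b) j ≡ δ j b
  colSum-point a b j = ≡.trans (sum-cong-≗ (λ i → ℤₚ.*-comm (δ i a) (δ j b)))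
                             (≡.trans (∑-*ˡ e (δ j b) (λ i → δ i a)) (≡.trans (≡.cong (δ j b *_) (∑-δ a)) (ℤₚ.*-identityʳ (δ j b))))

  diagSum-point : ∀ a b d → diagSum (point a b) d ≡ δ d (a ⊖ b)
  diagSum-point a b d = begin
    ∑[ j < e ] (δ (j ⊕ d) a * δ j b) ≡⟨ sum-cong-≗ (λ j → ℤₚ.*-comm (δ (j ⊕ d) a) (δ j b)) ⟩
    ∑[ j < e ] (δ j b * δ (j ⊕ d) a) ≡⟨ ∑-δˡ b (λ j → δ (j ⊕ d) a) ⟩
    δ (b ⊕ d) a                      ≡⟨ ≡.trans (δ-sym (b ⊕ d) a) (≡.trans (≡.cong (δ a) (⊕-comm b d)) (δ-⊕ a d b)) ⟩
    δ d (a ⊖ b)                      ∎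

  rowSum-*-+ : ∀ s u v a → rowSum (λ i j → s * u i j + v i j) a ≡ s * rowSum u a + rowSum v a
  rowSum-*-+ s u v a = ∑-*-+ e s (u a) (v a)

  colSum-*-+ : ∀ s u v b → colSum (λ i j → s * u i j + v i j) b ≡ s * colSum u b + colSum v b
  colSum-*-+ s u v b = ∑-*-+ e s (λ i → u i b) (λ i → v i b)

  diagSum-*-+ : ∀ s u v d → diagSum (λ i j → s * u i j + v i j) d ≡ s * diagSum u d + diagSum v d
  diagSum-*-+ s u v d = ∑-*-+ e s (λ j → u (j ⊕ d) j) (λ j → v (j ⊕ d) j)

  ⟨⟩-comm : ∀ u v → ⟨ u , v ⟩ ≡ ⟨ v , u ⟩
  ⟨⟩-comm u v = sum-cong-≗ (λ i → sum-cong-≗ (λ j → ℤₚ.*-comm (u i j) (v i j)))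

  ⟨⟩-+ : ∀ g u v → ⟨ g , (λ i j → u i j + v i j) ⟩ ≡ ⟨ g , u ⟩ + ⟨ g , v ⟩
  ⟨⟩-+ g u v = ≡.trans (sum-cong-≗ (λ i → ≡.trans (sum-cong-≗ (λ j → ℤₚ.*-distribˡ-+ (g i j) (u i j) (v i j)))
                                              (∑-distrib-+ (λ j → g i j * u i j) (λ j → g i j * v i j))))
                     (∑-distrib-+ (λ i → ∑[ j < e ] (g i j * u i j)) (λ i → ∑[ j < e ] (g i j * v i j)))

  ⟨⟩-* : ∀ g s u → ⟨ g , (λ i j → s * u i j) ⟩ ≡ s * ⟨ g , u ⟩
  ⟨⟩-* g s u = ≡.trans (sum-cong-≗ (λ i → ≡.trans (sum-cong-≗ (λ j → swap (g i j) s (u i j)))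
                                             (∑-*ˡ e s (λ j → g i j * u i j))))
                     (∑-*ˡ e s (λ i → ∑[ j < e ] (g i j * u i j)))
    where
    swap : ∀ x y z → x * (y * z) ≡ y * (x * z)
    swap = ZSolver.solve-∀

  ⟨⟩-*-+ : ∀ g s u v → ⟨ g , (λ i j → s * u i j + v i j) ⟩ ≡ s * ⟨ g , u ⟩ + ⟨ g , v ⟩
  ⟨⟩-*-+ g s u v = ≡.trans (⟨⟩-+ g (λ i j → s * u i j) v) (≡.cong (_+ ⟨ g , v ⟩) (⟨⟩-* g s u))

  ⟨⟩-const : ∀ g α → ⟨ g , (λ _ _ → α) ⟩ ≡ α * total g
  ⟨⟩-const g α = ≡.trans (sum-cong-≗ (λ i → ≡.trans (sum-cong-≗ (λ j → ℤₚ.*-comm (g i j) α)) (∑-*ˡ e α (g i))))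
                       (∑-*ˡ e α (rowSum g))

  ⟨⟩-row : ∀ g a → ⟨ g , (λ i _ → δ i a) ⟩ ≡ rowSum g a
  ⟨⟩-row g a = begin
    ∑[ i < e ] ∑[ j < e ] (g i j * δ i a) ≡⟨ sum-cong-≗ (λ i → ≡.trans (sum-cong-≗ (λ j → ℤₚ.*-comm (g i j) (δ i a)))
                                                                      (∑-*ˡ e (δ i a) (g i))) ⟩
    ∑[ i < e ] (δ i a * rowSum g i)        ≡⟨ ∑-δˡ a (rowSum g) ⟩
    rowSum g a                             ∎

  ⟨⟩-col : ∀ g b → ⟨ g , (λ _ j → δ j b) ⟩ ≡ colSum g b
  ⟨⟩-col g b = sum-cong-≗ (λ i → ≡.trans (sum-cong-≗ (λ j → ℤₚ.*-comm (g i j) (δ j b))) (∑-δˡ b (g i)))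

  ⟨⟩-diag : ∀ g d → ⟨ g , (λ i j → δ i (j ⊕ d)) ⟩ ≡ diagSum g d
  ⟨⟩-diag g d = begin
    ∑[ i < e ] ∑[ j < e ] (g i j * δ i (j ⊕ d)) ≡⟨ ∑-comm (λ i j → g i j * δ i (j ⊕ d)) ⟩
    ∑[ j < e ] ∑[ i < e ] (g i j * δ i (j ⊕ d)) ≡⟨ sum-cong-≗ (λ j → ≡.trans (sum-cong-≗ (λ i → ℤₚ.*-comm (g i j) _))
                                                                          (∑-δˡ (j ⊕ d) (λ i → g i j))) ⟩
    diagSum g d                                 ∎

  ⟨⟩-point : ∀ g a b → ⟨ g , point a b ⟩ ≡ g a b
  ⟨⟩-point g a b = begin
    ∑[ i < e ] ∑[ j < e ] (g i j * (δ i a * δ j b))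
      ≡⟨ sum-cong-≗ (λ i → ≡.trans (sum-cong-≗ (λ j → reorder (g i j) (δ i a) (δ j b)))
                                (≡.trans (∑-*ˡ e (δ i a) (λ j → δ j b * g i j)) (≡.cong (δ i a *_) (∑-δˡ b (g i))))) ⟩
    ∑[ i < e ] (δ i a * g i b) ≡⟨ ∑-δˡ a (λ i → g i b) ⟩
    g a b                      ∎
    where
    reorder : ∀ x y z → x * (y * z) ≡ y * (z * x)
    reorder = ZSolver.solve-∀

  ⟨⟩-line : ∀ g α β γ ε a b d →
            ⟨ g , line α β γ ε a b d ⟩ ≡ α * total g + β * rowSum g a + γ * colSum g b + ε * diagSum g d
  ⟨⟩-line g α β γ ε a b d = begin
    ⟨ g , line α β γ ε a b d ⟩
      ≡⟨ ⟨⟩-+ g _ _ ⟩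
    ⟨ g , (λ i j → α + β * δ i a + γ * δ j b) ⟩ + ⟨ g , (λ i j → ε * δ i (j ⊕ d)) ⟩
      ≡⟨ ≡.cong₂ _+_ (⟨⟩-+ g _ _) (≡.trans (⟨⟩-* g ε _) (≡.cong (ε *_) (⟨⟩-diag g d))) ⟩
    ⟨ g , (λ i j → α + β * δ i a) ⟩ + ⟨ g , (λ i j → γ * δ j b) ⟩ + ε * diagSum g d
      ≡⟨ ≡.cong₂ (λ s t → s + t + ε * diagSum g d) (⟨⟩-+ g _ _) (≡.trans (⟨⟩-* g γ _) (≡.cong (γ *_) (⟨⟩-col g b))) ⟩
    ⟨ g , (λ _ _ → α) ⟩ + ⟨ g , (λ i j → β * δ i a) ⟩ + γ * colSum g b + ε * diagSum g d
      ≡⟨ ≡.cong₂ (λ s t → s + t + γ * colSum g b + ε * diagSum g d)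
               (⟨⟩-const g α) (≡.trans (⟨⟩-* g β _) (≡.cong (β *_) (⟨⟩-row g a))) ⟩
    α * total g + β * rowSum g a + γ * colSum g b + ε * diagSum g d ∎

  total-vanishing : ∀ {g} → VanishingLineSums g → total g ≡ 0ℤ
  total-vanishing v = ≡.trans (sum-cong-≗ (VanishingLineSums.rows v)) (≡.trans (∑-const e 0ℤ) (ℤₚ.*-zeroʳ E))

  ⟨⟩-line-vanishing : ∀ {g} → VanishingLineSums g → ∀ α β γ ε a b d → ⟨ g , line α β γ ε a b d ⟩ ≡ 0ℤ
  ⟨⟩-line-vanishing {g} v α β γ ε a b d
    rewrite ⟨⟩-line g α β γ ε a b d | total-vanishing v
          | VanishingLineSums.rows v a | VanishingLineSums.cols v b | VanishingLineSums.diags v d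
    = zeros α β γ ε
    where
    zeros : ∀ α β γ ε → α * 0ℤ + β * 0ℤ + γ * 0ℤ + ε * 0ℤ ≡ 0ℤ
    zeros = ZSolver.solve-∀

  ⟨⟩-nonneg : ∀ u → 0ℤ ℤ.≤ ⟨ u , u ⟩
  ⟨⟩-nonneg u = ∑-nonneg _ (λ i → ∑-nonneg _ (λ j → square-nonneg (u i j)))

  ⟨⟩-definite : ∀ u → ⟨ u , u ⟩ ≡ 0ℤ → ∀ i j → u i j ≡ 0ℤ
  ⟨⟩-definite u ⟨u,u⟩≡0 i j = square≡0 (u i j)
    (∑-nonneg-≡0 _ (λ j → square-nonneg (u i j))
      (∑-nonneg-≡0 _ (λ i → ∑-nonneg _ (λ j → square-nonneg (u i j))) ⟨u,u⟩≡0 i) j)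

  private
    cancel-nonneg : ∀ B X → 0ℤ ℤ.≤ B → B ≢ 0ℤ → 0ℤ ℤ.≤ B * X → 0ℤ ℤ.≤ X
    cancel-nonneg (+ ℕ.zero)  X _ B≢0 _    = ⊥-elim (B≢0 ≡.refl)
    cancel-nonneg +[1+ n ] X _ _   0≤BX = ℤₚ.*-cancelˡ-≤-pos 0ℤ X +[1+ n ] (≡.subst (ℤ._≤ +[1+ n ] * X) (≡.sym (ℤₚ.*-zeroʳ +[1+ n ])) 0≤BX)

  cauchy-schwarz : ∀ u v → ⟨ u , v ⟩ * ⟨ u , v ⟩ ℤ.≤ ⟨ u , u ⟩ * ⟨ v , v ⟩
  cauchy-schwarz u v with ⟨ v , v ⟩ ℤ.≟ 0ℤ
  ... | yes ‖v‖²≡0 = ≡.subst₂ ℤ._≤_ (≡.sym (≡.cong₂ _*_ ⟨u,v⟩≡0 ⟨u,v⟩≡0)) (≡.sym (≡.trans (≡.cong (‖u‖² *_) ‖v‖²≡0) (ℤₚ.*-zeroʳ ‖u‖²))) ℤₚ.≤-refl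
    where
    ‖u‖² = ⟨ u , u ⟩
    ⟨u,v⟩≡0 : ⟨ u , v ⟩ ≡ 0ℤ
    ⟨u,v⟩≡0 = ≡.trans (sum-cong-≗ (λ i → sum-cong-≗ (λ j → ≡.cong (u i j *_) (⟨⟩-definite v ‖v‖²≡0 i j))))
                (≡.trans (⟨⟩-const u 0ℤ) (ℤₚ.*-zeroˡ (total u)))
  ... | no ‖v‖²≢0 = ℤₚ.0≤i-j⇒j≤i (cancel-nonneg ‖v‖² (‖u‖² * ‖v‖² - ⟨u,v⟩ * ⟨u,v⟩) (⟨⟩-nonneg v) ‖v‖²≢0 (≡.subst (0ℤ ℤ.≤_) ⟨r,r⟩ (⟨⟩-nonneg r)))
    where
    ‖u‖² = ⟨ u , u ⟩
    ‖v‖² = ⟨ v , v ⟩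
    ⟨u,v⟩ = ⟨ u , v ⟩
    r : Array
    r i j = ‖v‖² * u i j + (- ⟨u,v⟩) * v i j
    ⟨⟩-r : ∀ g → ⟨ g , r ⟩ ≡ ‖v‖² * ⟨ g , u ⟩ + (- ⟨u,v⟩) * ⟨ g , v ⟩
    ⟨⟩-r g = ≡.trans (⟨⟩-*-+ g ‖v‖² u _) (≡.cong (_+_ (‖v‖² * ⟨ g , u ⟩)) (⟨⟩-* g (- ⟨u,v⟩) v))
    ⟨r,r⟩ : ⟨ r , r ⟩ ≡ ‖v‖² * (‖u‖² * ‖v‖² - ⟨u,v⟩ * ⟨u,v⟩)
    ⟨r,r⟩ = begin
      ⟨ r , r ⟩                                          ≡⟨ ⟨⟩-r r ⟩
      ‖v‖² * ⟨ r , u ⟩ + (- ⟨u,v⟩) * ⟨ r , v ⟩                  ≡⟨ ≡.cong₂ (λ s t → ‖v‖² * s + (- ⟨u,v⟩) * t)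
                                                                  (≡.trans (⟨⟩-comm r u) (⟨⟩-r u))
                                                                  (≡.trans (⟨⟩-comm r v) (≡.trans (⟨⟩-r v) (≡.cong (λ t → ‖v‖² * t + (- ⟨u,v⟩) * ‖v‖²) (⟨⟩-comm v u)))) ⟩
      ‖v‖² * (‖v‖² * ‖u‖² + (- ⟨u,v⟩) * ⟨u,v⟩) + (- ⟨u,v⟩) * (‖v‖² * ⟨u,v⟩ + (- ⟨u,v⟩) * ‖v‖²) ≡⟨ expand ‖u‖² ‖v‖² ⟨u,v⟩ ⟩
      ‖v‖² * (‖u‖² * ‖v‖² - ⟨u,v⟩ * ⟨u,v⟩)                                ∎
      where
      expand : ∀ A B C → B * (B * A + (- C) * C) + (- C) * (B * C + (- C) * B) ≡ B * (A * B - C * C)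
      expand = ZSolver.solve-∀

  -- e² times the orthogonal projection of the point mass at (a , b) onto the arrays with vanishing line sums.
  kernel : Fin e → Fin e → Array
  kernel a b i j = E * E * point a b i j + line (+ 2) (- E) (- E) (- E) a b (a ⊖ b) i j

  kernel-vanishing : ∀ a b → VanishingLineSums (kernel a b)
  kernel-vanishing a b = record { rows = rows ; cols = cols ; diags = diags }
    where
    rows : ∀ i → rowSum (kernel a b) i ≡ 0ℤ
    rows i rewrite rowSum-*-+ (E * E) (point a b) (line (+ 2) (- E) (- E) (- E) a b (a ⊖ b)) i
                 | rowSum-point a b i | rowSum-line (+ 2) (- E) (- E) (- E) a b (a ⊖ b) i
      = cancels E (δ i a)
      where
      cancels : ∀ E x → E * E * x + (E * + 2 + (- E) * (E * x) + (- E) * 1ℤ + (- E) * 1ℤ) ≡ 0ℤ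
      cancels = ZSolver.solve-∀
    cols : ∀ j → colSum (kernel a b) j ≡ 0ℤ
    cols j rewrite colSum-*-+ (E * E) (point a b) (line (+ 2) (- E) (- E) (- E) a b (a ⊖ b)) j
                 | colSum-point a b j | colSum-line (+ 2) (- E) (- E) (- E) a b (a ⊖ b) j
      = cancels E (δ j b)
      where
      cancels : ∀ E x → E * E * x + (E * + 2 + (- E) * 1ℤ + (- E) * (E * x) + (- E) * 1ℤ) ≡ 0ℤ
      cancels = ZSolver.solve-∀
    diags : ∀ d → diagSum (kernel a b) d ≡ 0ℤ
    diags d rewrite diagSum-*-+ (E * E) (point a b) (line (+ 2) (- E) (- E) (- E) a b (a ⊖ b)) d
                  | diagSum-point a b d | diagSum-line (+ 2) (- E) (- E) (- E) a b (a ⊖ b) d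
      = cancels E (δ d (a ⊖ b))
      where
      cancels : ∀ E x → E * E * x + (E * + 2 + (- E) * 1ℤ + (- E) * 1ℤ + (- E) * (E * x)) ≡ 0ℤ
      cancels = ZSolver.solve-∀

  ⟨⟩-kernel : ∀ {g} → VanishingLineSums g → ∀ a b → ⟨ g , kernel a b ⟩ ≡ E * E * g a b
  ⟨⟩-kernel {g} v a b = begin
    ⟨ g , kernel a b ⟩
      ≡⟨ ⟨⟩-*-+ g (E * E) (point a b) _ ⟩
    E * E * ⟨ g , point a b ⟩ + ⟨ g , line (+ 2) (- E) (- E) (- E) a b (a ⊖ b) ⟩
      ≡⟨ ≡.cong₂ (λ s t → E * E * s + t) (⟨⟩-point g a b) (⟨⟩-line-vanishing v (+ 2) (- E) (- E) (- E) a b (a ⊖ b)) ⟩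
    E * E * g a b + 0ℤ
      ≡⟨ ℤₚ.+-identityʳ _ ⟩
    E * E * g a b ∎

  kernel-diagonal : ∀ a b → kernel a b a b ≡ (E - 1ℤ) * (E - + 2)
  kernel-diagonal a b = begin
    E * E * (δ a a * δ b b) + (+ 2 + (- E) * δ a a + (- E) * δ b b + (- E) * δ a (b ⊕ (a ⊖ b)))
      ≡⟨ ≡.cong₂ (λ x y → E * E * (x * y) + (+ 2 + (- E) * x + (- E) * y + (- E) * δ a (b ⊕ (a ⊖ b))))
               (δ-refl a) (δ-refl b) ⟩
    E * E * (1ℤ * 1ℤ) + (+ 2 + (- E) * 1ℤ + (- E) * 1ℤ + (- E) * δ a (b ⊕ (a ⊖ b)))
      ≡⟨ ≡.cong (λ x → E * E * (1ℤ * 1ℤ) + (+ 2 + (- E) * 1ℤ + (- E) * 1ℤ + (- E) * x))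
              (𝟙-yes (≡.sym (≡.trans (⊕-comm b (a ⊖ b)) (⊖-⊕ a b)))) ⟩
    E * E * (1ℤ * 1ℤ) + (+ 2 + (- E) * 1ℤ + (- E) * 1ℤ + (- E) * 1ℤ)
      ≡⟨ value E ⟩
    (E - 1ℤ) * (E - + 2) ∎
    where
    value : ∀ E → E * E * (1ℤ * 1ℤ) + (+ 2 + (- E) * 1ℤ + (- E) * 1ℤ + (- E) * 1ℤ) ≡ (E - 1ℤ) * (E - + 2)
    value = ZSolver.solve-∀

  entry-bound : ∀ {g} → VanishingLineSums g → ∀ a b → E * E * (g a b * g a b) ℤ.≤ (E - 1ℤ) * (E - + 2) * ⟨ g , g ⟩
  entry-bound {g} v a b = ℤₚ.*-cancelˡ-≤-pos _ _ E (ℤₚ.*-cancelˡ-≤-pos _ _ E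
    (≡.subst₂ ℤ._≤_ (lhs E (g a b)) (rhs E ⟨ g , g ⟩) (≡.subst₂ ℤ._≤_ ⟨g,w⟩² ⟨g,g⟩⟨w,w⟩ (cauchy-schwarz g (kernel a b)))))
    where
    ⟨g,w⟩² : ⟨ g , kernel a b ⟩ * ⟨ g , kernel a b ⟩ ≡ E * E * g a b * (E * E * g a b)
    ⟨g,w⟩² = ≡.cong₂ _*_ (⟨⟩-kernel v a b) (⟨⟩-kernel v a b)
    ⟨g,g⟩⟨w,w⟩ : ⟨ g , g ⟩ * ⟨ kernel a b , kernel a b ⟩ ≡ ⟨ g , g ⟩ * (E * E * ((E - 1ℤ) * (E - + 2)))
    ⟨g,g⟩⟨w,w⟩ = ≡.cong (⟨ g , g ⟩ *_) (≡.trans (⟨⟩-kernel (kernel-vanishing a b) a b) (≡.cong (E * E *_) (kernel-diagonal a b)))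
    lhs : ∀ E x → E * E * x * (E * E * x) ≡ E * (E * (E * E * (x * x)))
    lhs = ZSolver.solve-∀
    rhs : ∀ E G → G * (E * E * ((E - 1ℤ) * (E - + 2))) ≡ E * (E * ((E - 1ℤ) * (E - + 2) * G))
    rhs = ZSolver.solve-∀

  -- c stands for the cyclotomic numbers of order e over a field with e k + 1 elements, a₀ for the class of -1.
  module _ (k : ℕ) (a₀ : Fin e) (c : Array)
           (rows  : ∀ a → rowSum c a ≡ + k - δ a a₀)
           (cols  : ∀ b → colSum c b ≡ + k - δ b 𝟘)
           (diags : ∀ d → diagSum c d ≡ + k - δ d 𝟘)
           (squares : ⟨ c , c ⟩ ≡ E * + k - 1ℤ + (+ k - 1ℤ) * (+ k - + 2))
    where

    private
      K N : ℤ
      K = + k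
      N = E * K + 1ℤ

    deviation : Array
    deviation i j = E * E * c i j + line (- (N + 1ℤ)) E E E a₀ 𝟘 𝟘 i j

    deviation-vanishing : VanishingLineSums deviation
    deviation-vanishing = record { rows = rows′ ; cols = cols′ ; diags = diags′ }
      where
      rows′ : ∀ i → rowSum deviation i ≡ 0ℤ
      rows′ i rewrite rowSum-*-+ (E * E) c (line (- (N + 1ℤ)) E E E a₀ 𝟘 𝟘) i
                    | rows i | rowSum-line (- (N + 1ℤ)) E E E a₀ 𝟘 𝟘 i
        = cancels E K (δ i a₀)
        where
        cancels : ∀ E K x → E * E * (K - x) + (E * - (E * K + 1ℤ + 1ℤ) + E * (E * x) + E * 1ℤ + E * 1ℤ) ≡ 0ℤ
        cancels = ZSolver.solve-∀
      cols′ : ∀ j → colSum deviation j ≡ 0ℤ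
      cols′ j rewrite colSum-*-+ (E * E) c (line (- (N + 1ℤ)) E E E a₀ 𝟘 𝟘) j
                    | cols j | colSum-line (- (N + 1ℤ)) E E E a₀ 𝟘 𝟘 j
        = cancels E K (δ j 𝟘)
        where
        cancels : ∀ E K x → E * E * (K - x) + (E * - (E * K + 1ℤ + 1ℤ) + E * 1ℤ + E * (E * x) + E * 1ℤ) ≡ 0ℤ
        cancels = ZSolver.solve-∀
      diags′ : ∀ d → diagSum deviation d ≡ 0ℤ
      diags′ d rewrite diagSum-*-+ (E * E) c (line (- (N + 1ℤ)) E E E a₀ 𝟘 𝟘) d
                     | diags d | diagSum-line (- (N + 1ℤ)) E E E a₀ 𝟘 𝟘 d
        = cancels E K (δ d 𝟘)
        where
        cancels : ∀ E K x → E * E * (K - x) + (E * - (E * K + 1ℤ + 1ℤ) + E * 1ℤ + E * 1ℤ + E * (E * x)) ≡ 0ℤ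
        cancels = ZSolver.solve-∀

    total-c : total c ≡ E * K - 1ℤ
    total-c = begin
      ∑[ a < e ] rowSum c a            ≡⟨ sum-cong-≗ (λ a → ≡.trans (rows a) (ℤₚ.+-comm K (- δ a a₀))) ⟩
      ∑[ a < e ] (- δ a a₀ + K)        ≡⟨ sum-cong-≗ (λ a → ≡.cong (_+ K) (≡.sym (ℤₚ.-1*i≡-i (δ a a₀)))) ⟩
      ∑[ a < e ] (- 1ℤ * δ a a₀ + K)   ≡⟨ ∑-*-+ e (- 1ℤ) (λ a → δ a a₀) (λ _ → K) ⟩
      - 1ℤ * ∑[ a < e ] δ a a₀ + ∑[ a < e ] K ≡⟨ ≡.cong₂ (λ s t → - 1ℤ * s + t) (∑-δ a₀) (∑-const e K) ⟩
      - 1ℤ * 1ℤ + E * K                 ≡⟨ ℤₚ.+-comm (- 1ℤ * 1ℤ) (E * K) ⟩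
      E * K - 1ℤ                        ∎

    deviation-norm : ⟨ deviation , deviation ⟩ ≡ E * E * ((E - 1ℤ) * (E - + 2)) * N
    deviation-norm = begin
      ⟨ deviation , deviation ⟩
        ≡⟨ ⟨⟩-*-+ deviation (E * E) c _ ⟩
      E * E * ⟨ deviation , c ⟩ + ⟨ deviation , line (- (N + 1ℤ)) E E E a₀ 𝟘 𝟘 ⟩
        ≡⟨ ≡.cong₂ (λ s t → E * E * s + t) (≡.trans (⟨⟩-comm deviation c) (⟨⟩-*-+ c (E * E) c _))
                 (⟨⟩-line-vanishing deviation-vanishing (- (N + 1ℤ)) E E E a₀ 𝟘 𝟘) ⟩
      E * E * (E * E * ⟨ c , c ⟩ + ⟨ c , line (- (N + 1ℤ)) E E E a₀ 𝟘 𝟘 ⟩) + 0ℤ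
        ≡⟨ ≡.cong (λ t → E * E * (E * E * ⟨ c , c ⟩ + t) + 0ℤ) (⟨⟩-line c (- (N + 1ℤ)) E E E a₀ 𝟘 𝟘) ⟩
      E * E * (E * E * ⟨ c , c ⟩ + (- (N + 1ℤ) * total c + E * rowSum c a₀ + E * colSum c 𝟘 + E * diagSum c 𝟘)) + 0ℤ
        ≡⟨ ≡.cong₂ (λ s t → E * E * (E * E * s + (- (N + 1ℤ) * t + E * rowSum c a₀ + E * colSum c 𝟘 + E * diagSum c 𝟘)) + 0ℤ)
                 squares total-c ⟩
      E * E * (E * E * (E * K - 1ℤ + (K - 1ℤ) * (K - + 2))
              + (- (N + 1ℤ) * (E * K - 1ℤ) + E * rowSum c a₀ + E * colSum c 𝟘 + E * diagSum c 𝟘)) + 0ℤ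
        ≡⟨ ≡.cong₂ (λ s t → E * E * (E * E * (E * K - 1ℤ + (K - 1ℤ) * (K - + 2))
                                   + (- (N + 1ℤ) * (E * K - 1ℤ) + E * s + E * t + E * diagSum c 𝟘)) + 0ℤ)
                 (≡.trans (rows a₀) (≡.cong (_-_ K) (δ-refl a₀))) (≡.trans (cols 𝟘) (≡.cong (_-_ K) (δ-refl 𝟘))) ⟩
      E * E * (E * E * (E * K - 1ℤ + (K - 1ℤ) * (K - + 2))
              + (- (N + 1ℤ) * (E * K - 1ℤ) + E * (K - 1ℤ) + E * (K - 1ℤ) + E * diagSum c 𝟘)) + 0ℤ
        ≡⟨ ≡.cong (λ t → E * E * (E * E * (E * K - 1ℤ + (K - 1ℤ) * (K - + 2))
                                + (- (N + 1ℤ) * (E * K - 1ℤ) + E * (K - 1ℤ) + E * (K - 1ℤ) + E * t)) + 0ℤ)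
                (≡.trans (diags 𝟘) (≡.cong (_-_ K) (δ-refl 𝟘))) ⟩
      E * E * (E * E * (E * K - 1ℤ + (K - 1ℤ) * (K - + 2))
              + (- (E * K + 1ℤ + 1ℤ) * (E * K - 1ℤ) + E * (K - 1ℤ) + E * (K - 1ℤ) + E * (K - 1ℤ))) + 0ℤ
        ≡⟨ simplify E K ⟩
      E * E * ((E - 1ℤ) * (E - + 2)) * N ∎
      where
      simplify : ∀ E K → E * E * (E * E * (E * K - 1ℤ + (K - 1ℤ) * (K - + 2))
                                  + (- (E * K + 1ℤ + 1ℤ) * (E * K - 1ℤ) + E * (K - 1ℤ) + E * (K - 1ℤ) + E * (K - 1ℤ))) + 0ℤ
                         ≡ E * E * ((E - 1ℤ) * (E - + 2)) * (E * K + 1ℤ)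
      simplify = ZSolver.solve-∀

    deviation-bound : ∀ a b → deviation a b * deviation a b ℤ.≤ (E - 1ℤ) * (E - + 2) * ((E - 1ℤ) * (E - + 2)) * N
    deviation-bound a b = ℤₚ.*-cancelˡ-≤-pos _ _ E (ℤₚ.*-cancelˡ-≤-pos _ _ E
      (≡.subst₂ ℤ._≤_ (ℤₚ.*-assoc E E _) (regroup E ((E - 1ℤ) * (E - + 2)) N)
        (≡.subst ((E * E * (deviation a b * deviation a b)) ℤ.≤_) (≡.cong ((E - 1ℤ) * (E - + 2) *_) deviation-norm)
          (entry-bound deviation-vanishing a b))))
      where
      regroup : ∀ E L N → L * (E * E * L * N) ≡ E * (E * (L * L * N))
      regroup = ZSolver.solve-∀

-- The ring solver normalises coefficients by computation, so they are taken in ℤ and mapped into R.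
module IntegerCoefficients {c ℓ : Level} (R : CommutativeRing c ℓ) where
  open CommutativeRing R
  open Algebra.Properties.Monoid.Mult.TCOptimised +-monoid using (×-homo-+; 1+×) renaming (_×_ to _×′_)
  open Algebra.Properties.Semiring.Mult.TCOptimised semiring using (×1-homo-*)
  open Algebra.Properties.Ring ring using (-‿distribˡ-*; -‿distribʳ-*)
  open Algebra.Properties.Group +-group using (ε⁻¹≈ε; ⁻¹-involutive)
  open Algebra.Properties.AbelianGroup +-abelianGroup using (⁻¹-∙-comm)
  open Algebra.Properties.CommutativeSemigroup +-commutativeSemigroup using (interchange)
  open import Relation.Binary.Reasoning.Setoid setoid

  ι : ℤ → Carrier
  ι (+ n)    = n ×′ 1#
  ι -[1+ n ] = - (suc n ×′ 1#)

  ι-neg : ∀ i → ι (ℤ.- i) ≈ - ι i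
  ι-neg (+ zero)  = sym ε⁻¹≈ε
  ι-neg (+ suc n) = refl
  ι-neg -[1+ n ]  = sym (⁻¹-involutive _)

  ι-⊖ : ∀ m n → ι (m ℤ.⊖ n) ≈ m ×′ 1# - n ×′ 1#
  ι-⊖ zero    zero    = sym (-‿inverseʳ 0#)
  ι-⊖ zero    (suc n) = sym (+-identityˡ _)
  ι-⊖ (suc m) zero    = sym (trans (+-congˡ ε⁻¹≈ε) (+-identityʳ _))
  ι-⊖ (suc m) (suc n) = begin
    ι (suc m ℤ.⊖ suc n)                     ≡⟨ ≡.cong ι (ℤₚ.[1+m]⊖[1+n]≡m⊖n m n) ⟩
    ι (m ℤ.⊖ n)                             ≈⟨ ι-⊖ m n ⟩
    m ×′ 1# - n ×′ 1#                       ≈⟨ sym (+-identityˡ _) ⟩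
    0# + (m ×′ 1# - n ×′ 1#)                ≈⟨ +-congʳ (sym (-‿inverseʳ 1#)) ⟩
    (1# - 1#) + (m ×′ 1# - n ×′ 1#)         ≈⟨ interchange 1# (- 1#) (m ×′ 1#) (- (n ×′ 1#)) ⟩
    (1# + m ×′ 1#) + (- 1# - n ×′ 1#)       ≈⟨ +-congˡ (⁻¹-∙-comm 1# (n ×′ 1#)) ⟩
    (1# + m ×′ 1#) - (1# + n ×′ 1#)         ≈⟨ sym (+-cong (1+× m 1#) (-‿cong (1+× n 1#))) ⟩
    suc m ×′ 1# - suc n ×′ 1#               ∎

  ι-+ : ∀ i j → ι (i ℤ.+ j) ≈ ι i + ι j
  ι-+ (+ m)    (+ n)    = ×-homo-+ 1# m n
  ι-+ (+ m)    -[1+ n ] = ι-⊖ m (suc n)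
  ι-+ -[1+ m ] (+ n)    = trans (ι-⊖ n (suc m)) (+-comm _ _)
  ι-+ -[1+ m ] -[1+ n ] = begin
    - (suc (suc (m ℕ.+ n)) ×′ 1#)         ≡⟨ ≡.cong (λ k → - (suc k ×′ 1#)) (≡.sym (ℕₚ.+-suc m n)) ⟩
    - ((suc m ℕ.+ suc n) ×′ 1#)           ≈⟨ -‿cong (×-homo-+ 1# (suc m) (suc n)) ⟩
    - (suc m ×′ 1# + suc n ×′ 1#)          ≈⟨ sym (⁻¹-∙-comm _ _) ⟩
    - (suc m ×′ 1#) - (suc n ×′ 1#)        ∎

  ι-*-+ : ∀ m j → ι (+ m ℤ.* j) ≈ ι (+ m) * ι j
  ι-*-+ m (+ n)    = trans (reflexive (≡.cong ι (≡.sym (ℤₚ.pos-* m n)))) (×1-homo-* m n)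
  ι-*-+ m -[1+ n ] = begin
    ι (+ m ℤ.* ℤ.- + suc n)      ≡⟨ ≡.cong ι (≡.sym (ℤₚ.neg-distribʳ-* (+ m) (+ suc n))) ⟩
    ι (ℤ.- (+ m ℤ.* + suc n))    ≈⟨ ι-neg (+ m ℤ.* + suc n) ⟩
    - ι (+ m ℤ.* + suc n)        ≈⟨ -‿cong (ι-*-+ m (+ suc n)) ⟩
    - (ι (+ m) * ι (+ suc n))    ≈⟨ -‿distribʳ-* _ _ ⟩
    ι (+ m) * ι -[1+ n ]         ∎

  ι-* : ∀ i j → ι (i ℤ.* j) ≈ ι i * ι j
  ι-* (+ m)    j = ι-*-+ m j
  ι-* -[1+ m ] j = begin
    ι (ℤ.- + suc m ℤ.* j)        ≡⟨ ≡.cong ι (≡.sym (ℤₚ.neg-distribˡ-* (+ suc m) j)) ⟩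
    ι (ℤ.- (+ suc m ℤ.* j))      ≈⟨ ι-neg (+ suc m ℤ.* j) ⟩
    - ι (+ suc m ℤ.* j)          ≈⟨ -‿cong (ι-*-+ (suc m) j) ⟩
    - (ι (+ suc m) * ι j)        ≈⟨ -‿distribˡ-* _ _ ⟩
    ι -[1+ m ] * ι j             ∎

  ι-morphism : ℤ.+-*-rawRing -Raw-AlmostCommutative⟶ fromCommutativeRing R
  ι-morphism = record
    { ⟦_⟧ = ι ; +-homo = ι-+ ; *-homo = ι-* ; -‿homo = ι-neg
    ; 0-homo = refl ; 1-homo = refl }

  private
    ι-≟ : ∀ i j → Maybe (ι i ≈ ι j)
    ι-≟ i j with i ℤ.≟ j
    ... | yes i≡j = just (reflexive (≡.cong ι i≡j))
    ... | no _    = nothing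

  open Algebra.Solver.Ring ℤ.+-*-rawRing (fromCommutativeRing R) ι-morphism ι-≟ public

-- Finite fields

module FieldAlgebra {c ℓ : Level} {N : ℕ} (F : FiniteFieldWithGenerator c ℓ N) where
  open FiniteFieldWithGenerator F
  open IntegerCoefficients fieldRing using (solve; _:=_; _:+_; _:*_; :-_; _:-_; con)
  open Algebra.Properties.Group +-group using (x∙y⁻¹≈ε⇒x≈y; x≈y⇒x∙y⁻¹≈ε)
  open Relation.Binary.Reasoning.Setoid setoid

  -1# : Carrier
  -1# = - 1#

  1≉0 : 1# ≉ 0#
  1≉0 1≈0 = 0≉1 (sym 1≈0)

  -- Total inverse, with the junk value 0# ⁻¹ = 0#.
  infix 8 _⁻¹
  _⁻¹ : Carrier → Carrier
  x ⁻¹ with x ≟ 0#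
  ... | yes _   = 0#
  ... | no x≉0 = proj₁ (inverse x x≉0)

  *-inverseʳ : ∀ {x} → x ≉ 0# → x * x ⁻¹ ≈ 1#
  *-inverseʳ {x} x≉0 with x ≟ 0#
  ... | yes x≈0 = ⊥-elim (x≉0 x≈0)
  ... | no x≉0′ = proj₂ (inverse x x≉0′)

  *-cancelˡ : ∀ {x y z} → x ≉ 0# → x * y ≈ x * z → y ≈ z
  *-cancelˡ {x} {y} {z} x≉0 xy≈xz = begin
    y                  ≈⟨ sym (*-identityˡ y) ⟩
    1# * y             ≈⟨ *-congʳ (sym (trans (*-comm (x ⁻¹) x) (*-inverseʳ x≉0))) ⟩
    x ⁻¹ * x * y       ≈⟨ *-assoc (x ⁻¹) x y ⟩
    x ⁻¹ * (x * y)     ≈⟨ *-congˡ xy≈xz ⟩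
    x ⁻¹ * (x * z)     ≈⟨ sym (*-assoc (x ⁻¹) x z) ⟩
    x ⁻¹ * x * z       ≈⟨ *-congʳ (trans (*-comm (x ⁻¹) x) (*-inverseʳ x≉0)) ⟩
    1# * z             ≈⟨ *-identityˡ z ⟩
    z                  ∎

  zero-product : ∀ {x y} → x * y ≈ 0# → x ≈ 0# ⊎ y ≈ 0#
  zero-product {x} {y} xy≈0 with x ≟ 0#
  ... | yes x≈0 = inj₁ x≈0
  ... | no x≉0  = inj₂ (*-cancelˡ x≉0 (trans xy≈0 (sym (zeroʳ x))))

  *-≉0 : ∀ {x y} → x ≉ 0# → y ≉ 0# → x * y ≉ 0#
  *-≉0 x≉0 y≉0 xy≈0 with zero-product xy≈0
  ... | inj₁ x≈0 = x≉0 x≈0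
  ... | inj₂ y≈0 = y≉0 y≈0

  *⁻¹-* : ∀ b {c} → c ≉ 0# → b * c ⁻¹ * c ≈ b
  *⁻¹-* b {c} c≉0 = begin
    b * c ⁻¹ * c      ≈⟨ *-assoc b (c ⁻¹) c ⟩
    b * (c ⁻¹ * c)    ≈⟨ *-congˡ (trans (*-comm (c ⁻¹) c) (*-inverseʳ c≉0)) ⟩
    b * 1#            ≈⟨ *-identityʳ b ⟩
    b                 ∎

  ≈-*⁻¹ : ∀ {a b c} → c ≉ 0# → (a ≈ b * c ⁻¹) ⇔ (a * c ≈ b)
  ≈-*⁻¹ {a} {b} {c} c≉0 = mk⇔
    (λ a≈b/c → trans (*-congʳ a≈b/c) (*⁻¹-* b c≉0))
    (λ ac≈b → *-cancelˡ c≉0 (trans (*-comm c a) (trans ac≈b (trans (sym (*⁻¹-* b c≉0)) (*-comm (b * c ⁻¹) c)))))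

  ≈-by-difference : ∀ {a b c d} → a - b ≈ c - d → a ≈ b → c ≈ d
  ≈-by-difference {a} {b} {c} {d} a-b≈c-d a≈b = x∙y⁻¹≈ε⇒x≈y c d (trans (sym a-b≈c-d) (x≈y⇒x∙y⁻¹≈ε a≈b))

  +1≈0⇔≈-1 : ∀ {x} → (x + 1# ≈ 0#) ⇔ (x ≈ -1#)
  +1≈0⇔≈-1 {x} = mk⇔ (≈-by-difference (shift x)) (≈-by-difference (sym (shift x)))
    where
    shift : ∀ x → x + 1# - 0# ≈ x - -1#
    shift = solve 1 (λ x → x :+ con (+ 1) :- con (+ 0) := x :- :- con (+ 1)) refl

module FieldSums {c ℓ : Level} {N : ℕ} (F : FiniteFieldWithGenerator c ℓ N) where
  open FiniteFieldWithGenerator F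
  open FieldAlgebra F
  open IntegerCoefficients fieldRing using (solve; _:=_; _:+_; _:*_; :-_; _:-_; con)
  open Algebra.Properties.Group +-group using (x∙y⁻¹≈ε⇒x≈y; x≈y⇒x∙y⁻¹≈ε)
  open ≡.≡-Reasoning

  infixl 10 ∑F
  ∑F : (Carrier → ℤ) → ℤ
  ∑F f = ∑[ i < N ] f (enum i)

  syntax ∑F (λ x → t) = ∑[ x ∈F ] t

  ∑F-cong : ∀ {f g : Carrier → ℤ} → (∀ x → f x ≡ g x) → ∑F f ≡ ∑F g
  ∑F-cong f≗g = sum-cong-≗ (f≗g ∘ enum)

  ∑F-*ˡ : ∀ (c : ℤ) (f : Carrier → ℤ) → ∑[ x ∈F ] (c ℤ.* f x) ≡ c ℤ.* ∑F f
  ∑F-*ˡ c f = ∑-*ˡ N c (f ∘ enum)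

  ∑F-comm : ∀ (f : Carrier → Carrier → ℤ) → ∑[ x ∈F ] ∑[ y ∈F ] f x y ≡ ∑[ y ∈F ] ∑[ x ∈F ] f x y
  ∑F-comm f = ∑-comm (λ i j → f (enum i) (enum j))

  ∑F-point : ∀ (f : Carrier → ℤ) → f Preserves _≈_ ⟶ _≡_ → ∀ y → ∑[ x ∈F ] (𝟙 (x ≟ y) ℤ.* f x) ≡ f y
  ∑F-point f f-cong y = begin
    ∑[ i < N ] (𝟙 (enum i ≟ y) ℤ.* f (enum i))  ≡⟨ sum-cong-≗ (λ i → ≡.cong (ℤ._* f (enum i)) (𝟙-cong (index i) {enum i ≟ y} {i Fin.≟ idx y})) ⟩
    ∑[ i < N ] (δ i (idx y) ℤ.* f (enum i))     ≡⟨ ∑-δˡ (idx y) (f ∘ enum) ⟩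
    f (enum (idx y))                            ≡⟨ f-cong (enum-idx y) ⟩
    f y                                         ∎
    where
    idx : Carrier → Fin N
    idx x = proj₁ (enum-sur x)
    enum-idx : ∀ x → enum (idx x) ≈ x
    enum-idx x = proj₂ (enum-sur x)
    index : ∀ i → (enum i ≈ y) ⇔ (i ≡ idx y)
    index i = mk⇔ (λ i↦y → enum-inj i (idx y) (trans i↦y (sym (enum-idx y))))
                  (λ i≡idx → trans (reflexive (≡.cong enum i≡idx)) (enum-idx y))

  ∑F-punctured : ∀ (f : Carrier → ℤ) → f Preserves _≈_ ⟶ _≡_ → ∀ p →
                 ∑[ x ∈F ] (𝟙 (¬? (x ≟ p)) ℤ.* f x) ≡ ∑F f ℤ.- f p
  ∑F-punctured f f-cong p = begin
    ∑[ x ∈F ] (𝟙 (¬? (x ≟ p)) ℤ.* f x)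
      ≡⟨ ∑F-cong (λ x → ≡.trans (≡.cong (ℤ._* f x) (𝟙-¬ (x ≟ p))) (complement (𝟙 (x ≟ p)) (f x))) ⟩
    ∑[ x ∈F ] (ℤ.- 1ℤ ℤ.* (𝟙 (x ≟ p) ℤ.* f x) ℤ.+ f x)
      ≡⟨ ∑-*-+ N (ℤ.- 1ℤ) (λ i → 𝟙 (enum i ≟ p) ℤ.* f (enum i)) (f ∘ enum) ⟩
    ℤ.- 1ℤ ℤ.* ∑[ x ∈F ] (𝟙 (x ≟ p) ℤ.* f x) ℤ.+ ∑F f
      ≡⟨ ≡.cong (λ t → ℤ.- 1ℤ ℤ.* t ℤ.+ ∑F f) (∑F-point f f-cong p) ⟩
    ℤ.- 1ℤ ℤ.* f p ℤ.+ ∑F f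
      ≡⟨ rearrange (f p) (∑F f) ⟩
    ∑F f ℤ.- f p ∎
    where
    complement : ∀ i y → (1ℤ ℤ.- i) ℤ.* y ≡ ℤ.- 1ℤ ℤ.* (i ℤ.* y) ℤ.+ y
    complement = ZSolver.solve-∀
    rearrange : ∀ y s → ℤ.- 1ℤ ℤ.* y ℤ.+ s ≡ s ℤ.- y
    rearrange = ZSolver.solve-∀

  ∑F-split : ∀ (f : Carrier → ℤ) → f Preserves _≈_ ⟶ _≡_ → ∀ p →
              ∑F f ≡ f p ℤ.+ ∑[ x ∈F ] (𝟙 (¬? (x ≟ p)) ℤ.* f x)
  ∑F-split f f-cong p = ≡.trans (add-back (∑F f) (f p)) (≡.cong (ℤ._+_ (f p)) (≡.sym (∑F-punctured f f-cong p)))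
    where
    add-back : ∀ s y → s ≡ y ℤ.+ (s ℤ.- y)
    add-back = ZSolver.solve-∀

  -- Proved by counting the fibres of g, so no permutation of the enumeration is needed.
  ∑F-reindex : ∀ {p q} {P : Pred Carrier p} {Q : Pred Carrier q} (P? : Decidable P) (Q? : Decidable Q)
               (g h : Carrier → Carrier) →
               (∀ {x y} → P x → y ≈ g x → Q y × x ≈ h y) →
               (∀ {x y} → Q y → x ≈ h y → P x × y ≈ g x) →
               ∀ (f : Carrier → ℤ) → f Preserves _≈_ ⟶ _≡_ →
               ∑[ x ∈F ] (𝟙 (P? x) ℤ.* f (g x)) ≡ ∑[ y ∈F ] (𝟙 (Q? y) ℤ.* f y)
  ∑F-reindex {P = P} {Q} P? Q? g h to from f f-cong = begin
    ∑[ x ∈F ] (𝟙 (P? x) ℤ.* f (g x))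
      ≡⟨ ∑F-cong (λ x → ≡.cong (𝟙 (P? x) ℤ.*_) (≡.sym (∑F-point f f-cong (g x)))) ⟩
    ∑[ x ∈F ] (𝟙 (P? x) ℤ.* ∑[ y ∈F ] (𝟙 (y ≟ g x) ℤ.* f y))
      ≡⟨ ∑F-cong (λ x → ≡.sym (∑F-*ˡ (𝟙 (P? x)) (λ y → 𝟙 (y ≟ g x) ℤ.* f y))) ⟩
    ∑[ x ∈F ] ∑[ y ∈F ] (𝟙 (P? x) ℤ.* (𝟙 (y ≟ g x) ℤ.* f y))
      ≡⟨ ∑F-cong (λ x → ∑F-cong (λ y → fibre x y)) ⟩
    ∑[ x ∈F ] ∑[ y ∈F ] (𝟙 (Q? y) ℤ.* (𝟙 (x ≟ h y) ℤ.* f y))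
      ≡⟨ ∑F-comm (λ x y → 𝟙 (Q? y) ℤ.* (𝟙 (x ≟ h y) ℤ.* f y)) ⟩
    ∑[ y ∈F ] ∑[ x ∈F ] (𝟙 (Q? y) ℤ.* (𝟙 (x ≟ h y) ℤ.* f y))
      ≡⟨ ∑F-cong (λ y → ≡.trans (∑F-*ˡ (𝟙 (Q? y)) (λ x → 𝟙 (x ≟ h y) ℤ.* f y))
                               (≡.cong (𝟙 (Q? y) ℤ.*_) (∑F-point (λ _ → f y) (λ _ → ≡.refl) (h y)))) ⟩
    ∑[ y ∈F ] (𝟙 (Q? y) ℤ.* f y) ∎
    where
    fibre : ∀ x y → 𝟙 (P? x) ℤ.* (𝟙 (y ≟ g x) ℤ.* f y) ≡ 𝟙 (Q? y) ℤ.* (𝟙 (x ≟ h y) ℤ.* f y)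
    fibre x y = begin
      𝟙 (P? x) ℤ.* (𝟙 (y ≟ g x) ℤ.* f y)        ≡⟨ ≡.sym (ℤₚ.*-assoc (𝟙 (P? x)) _ _) ⟩
      𝟙 (P? x) ℤ.* 𝟙 (y ≟ g x) ℤ.* f y          ≡⟨ ≡.cong (ℤ._* f y) (≡.sym (𝟙-× (P? x) (y ≟ g x))) ⟩
      𝟙 (P? x ×-dec y ≟ g x) ℤ.* f y            ≡⟨ ≡.cong (ℤ._* f y) (𝟙-cong (mk⇔ (λ (Px , y≈gx) → to Px y≈gx)
                                                                           (λ (Qy , x≈hy) → from Qy x≈hy))
                                                                     {P? x ×-dec y ≟ g x} {Q? y ×-dec x ≟ h y}) ⟩
      𝟙 (Q? y ×-dec x ≟ h y) ℤ.* f y            ≡⟨ ≡.cong (ℤ._* f y) (𝟙-× (Q? y) (x ≟ h y)) ⟩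
      𝟙 (Q? y) ℤ.* 𝟙 (x ≟ h y) ℤ.* f y          ≡⟨ ℤₚ.*-assoc (𝟙 (Q? y)) _ _ ⟩
      𝟙 (Q? y) ℤ.* (𝟙 (x ≟ h y) ℤ.* f y)        ∎

  möbius-reindex : ∀ α β → α ≉ β → ∀ (f : Carrier → ℤ) → f Preserves _≈_ ⟶ _≡_ →
                   ∑[ x ∈F ] (𝟙 (¬? (x ≟ -1#)) ℤ.* f ((α * x + β) * (x + 1#) ⁻¹))
                   ≡ ∑[ s ∈F ] (𝟙 (¬? (s ≟ α)) ℤ.* f s)
  möbius-reindex α β α≉β = ∑F-reindex (λ x → ¬? (x ≟ -1#)) (λ s → ¬? (s ≟ α))
                             (λ x → (α * x + β) * (x + 1#) ⁻¹) (λ s → (s - β) * (α - s) ⁻¹) forward backward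
    where
    difference : ∀ x s → α * x + β - s * (x + 1#) ≈ x * (α - s) - (s - β)
    difference = solve 4 (λ α β x s → α :* x :+ β :- s :* (x :+ con (+ 1)) := x :* (α :- s) :- (s :- β)) refl α β

    linear : ∀ {x s} → (s * (x + 1#) ≈ α * x + β) ⇔ (x * (α - s) ≈ s - β)
    linear {x} {s} = mk⇔ (≈-by-difference (difference x s) ∘ sym)
                         (sym ∘ ≈-by-difference (sym (difference x s)))

    α-s≉0 : ∀ {s} → s ≉ α → α - s ≉ 0#
    α-s≉0 {s} s≉α α-s≈0 = s≉α (sym (x∙y⁻¹≈ε⇒x≈y α s α-s≈0))

    x+1≉0 : ∀ {x} → x ≉ -1# → x + 1# ≉ 0#
    x+1≉0 x≉-1 = x≉-1 ∘ Equivalence.to +1≈0⇔≈-1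

    forward : ∀ {x s} → x ≉ -1# → s ≈ (α * x + β) * (x + 1#) ⁻¹ → s ≉ α × x ≈ (s - β) * (α - s) ⁻¹
    forward {x} {s} x≉-1 s≈μx = s≉α , Equivalence.from (≈-*⁻¹ (α-s≉0 s≉α)) solution
      where
      solution : x * (α - s) ≈ s - β
      solution = Equivalence.to linear (Equivalence.to (≈-*⁻¹ (x+1≉0 x≉-1)) s≈μx)
      s≉α : s ≉ α
      s≉α s≈α = α≉β (trans (sym s≈α) (x∙y⁻¹≈ε⇒x≈y s β
                  (trans (sym solution) (trans (*-congˡ (x≈y⇒x∙y⁻¹≈ε (sym s≈α))) (zeroʳ x)))))

    backward : ∀ {s x} → s ≉ α → x ≈ (s - β) * (α - s) ⁻¹ → x ≉ -1# × s ≈ (α * x + β) * (x + 1#) ⁻¹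
    backward {s} {x} s≉α x≈μ⁻¹s = x≉-1 , Equivalence.from (≈-*⁻¹ (x+1≉0 x≉-1)) image
      where
      image : s * (x + 1#) ≈ α * x + β
      image = Equivalence.from linear (Equivalence.to (≈-*⁻¹ (α-s≉0 s≉α)) x≈μ⁻¹s)
      at-minus-one : ∀ α β → α * -1# + β ≈ β - α
      at-minus-one = solve 2 (λ α β → α :* :- con (+ 1) :+ β := β :- α) refl
      x≉-1 : x ≉ -1#
      x≉-1 x≈-1 = α≉β (sym (x∙y⁻¹≈ε⇒x≈y β α
        (trans (sym (at-minus-one α β)) (trans (+-congʳ (*-congˡ (sym x≈-1)))
        (trans (sym image) (trans (*-congˡ (Equivalence.from +1≈0⇔≈-1 x≈-1)) (zeroʳ s)))))))

module DiscreteLog {c ℓ : Level} {L : ℕ} (F : FiniteFieldWithGenerator c ℓ (suc L)) (1<L : 1 ℕ.< L) where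
  open FiniteFieldWithGenerator F
  open FieldAlgebra F
  open FieldSums F
  open IntegerCoefficients fieldRing using (solve; _:=_; _:+_; _:*_; :-_; _:-_; con)
  open Algebra.Properties.Group +-group using (x∙y⁻¹≈ε⇒x≈y; x≈y⇒x∙y⁻¹≈ε)

  instance
    L-nonZero : NonZero L
    L-nonZero = ℕ.>-nonZero (ℕₚ.<-trans ℕₚ.0<1+n 1<L)

  infix 25 ω^_
  ω^_ : ℕ → Carrier
  ω^ n = pow fieldRing ω n

  ω^-+ : ∀ m n → ω^ (m ℕ.+ n) ≈ ω^ m * ω^ n
  ω^-+ zero    n = sym (*-identityˡ (ω^ n))
  ω^-+ (suc m) n = trans (*-congˡ (ω^-+ m n)) (sym (*-assoc ω (ω^ m) (ω^ n)))

  private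
    idx : Carrier → Fin (suc L)
    idx x = proj₁ (enum-sur x)

    enum-idx : ∀ x → enum (idx x) ≈ x
    enum-idx x = proj₂ (enum-sur x)

    idx-injective : ∀ {x y} → idx x ≡ idx y → x ≈ y
    idx-injective {x} {y} eq = trans (sym (enum-idx x)) (trans (reflexive (≡.cong enum eq)) (enum-idx y))

    idx-0≢ : ∀ {x} → x ≉ 0# → idx 0# ≢ idx x
    idx-0≢ x≉0 eq = x≉0 (idx-injective (≡.sym eq))

    nonzero-index : ∀ x → x ≉ 0# → Fin L
    nonzero-index x x≉0 = Fin.punchOut (idx-0≢ x≉0)

    nonzero-index-injective : ∀ {x y} (x≉0 : x ≉ 0#) (y≉0 : y ≉ 0#) →
                              nonzero-index x x≉0 ≡ nonzero-index y y≉0 → x ≈ y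
    nonzero-index-injective x≉0 y≉0 eq = idx-injective (Finₚ.punchOut-injective (idx-0≢ x≉0) (idx-0≢ y≉0) eq)

    nonzero-element : Fin L → Carrier
    nonzero-element j = enum (Fin.punchIn (idx 0#) j)

    nonzero-element-≉0 : ∀ j → nonzero-element j ≉ 0#
    nonzero-element-≉0 j ≈0 = Finₚ.punchInᵢ≢i (idx 0#) j (enum-inj _ _ (trans ≈0 (sym (enum-idx 0#))))

    nonzero-element-injective : ∀ {j j′} → nonzero-element j ≈ nonzero-element j′ → j ≡ j′
    nonzero-element-injective eq = Finₚ.punchIn-injective (idx 0#) _ _ (enum-inj _ _ eq)

  ω≉0 : ω ≉ 0#
  ω≉0 ω≈0 = ℕₚ.<⇒≱ 1<L (Finₚ.injective⇒≤ {f = λ (_ : Fin L) → Fin.zero {0}} (λ _ → nonzero-element-injective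
              (trans (is-one _) (sym (is-one _)))))
    where
    is-one : ∀ j → nonzero-element j ≈ 1#
    is-one j with ω-gen (nonzero-element j) (nonzero-element-≉0 j)
    ... | zero  , x≈1   = x≈1
    ... | suc i , x≈ω^i = ⊥-elim (nonzero-element-≉0 j (trans x≈ω^i (trans (*-congʳ ω≈0) (zeroˡ _))))

  ω^≉0 : ∀ n → ω^ n ≉ 0#
  ω^≉0 zero    = 1≉0
  ω^≉0 (suc n) = *-≉0 ω≉0 (ω^≉0 n)

  ω^-periodic : ∀ {m} → ω^ m ≈ 1# → ∀ q n → ω^ (n ℕ.+ q ℕ.* m) ≈ ω^ n
  ω^-periodic {m} ω^m≈1 zero    n = reflexive (≡.cong ω^_ (ℕₚ.+-identityʳ n))
  ω^-periodic {m} ω^m≈1 (suc q) n = begin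
    ω^ (n ℕ.+ (m ℕ.+ q ℕ.* m))    ≡⟨ ≡.cong ω^_ (≡.trans (≡.cong (n ℕ.+_) (ℕₚ.+-comm m (q ℕ.* m))) (≡.sym (ℕₚ.+-assoc n (q ℕ.* m) m))) ⟩
    ω^ (n ℕ.+ q ℕ.* m ℕ.+ m)      ≈⟨ ω^-+ (n ℕ.+ q ℕ.* m) m ⟩
    ω^ (n ℕ.+ q ℕ.* m) * ω^ m     ≈⟨ *-congˡ ω^m≈1 ⟩
    ω^ (n ℕ.+ q ℕ.* m) * 1#       ≈⟨ *-identityʳ _ ⟩
    ω^ (n ℕ.+ q ℕ.* m)            ≈⟨ ω^-periodic ω^m≈1 q n ⟩
    ω^ n                          ∎
    where open Relation.Binary.Reasoning.Setoid setoid

  ω^-mod : ∀ {m} ⦃ _ : NonZero m ⦄ → ω^ m ≈ 1# → ∀ n → ω^ n ≈ ω^ (n % m)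
  ω^-mod {m} ω^m≈1 n = trans (reflexive (≡.cong ω^_ (m≡m%n+[m/n]*n n m))) (ω^-periodic ω^m≈1 (n / m) (n % m))

  ω^-∸ : ∀ {i j} → i ℕ.≤ j → ω^ i ≈ ω^ j → ω^ (j ∸ i) ≈ 1#
  ω^-∸ {i} {j} i≤j ω^i≈ω^j = *-cancelˡ (ω^≉0 i) (begin
    ω^ i * ω^ (j ∸ i)   ≈⟨ sym (ω^-+ i (j ∸ i)) ⟩
    ω^ (i ℕ.+ (j ∸ i))  ≡⟨ ≡.cong ω^_ (ℕₚ.m+[n∸m]≡n i≤j) ⟩
    ω^ j                ≈⟨ sym ω^i≈ω^j ⟩
    ω^ i                ≈⟨ sym (*-identityʳ (ω^ i)) ⟩
    ω^ i * 1#           ∎)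
    where open Relation.Binary.Reasoning.Setoid setoid

  order-lower-bound : ∀ m ⦃ _ : NonZero m ⦄ → ω^ m ≈ 1# → L ℕ.≤ m
  order-lower-bound m ω^m≈1 = Finₚ.injective⇒≤ {f = residue} residue-injective
    where
    exponent : Fin L → ℕ
    exponent j = proj₁ (ω-gen (nonzero-element j) (nonzero-element-≉0 j))
    residue : Fin L → Fin m
    residue j = exponent j mod m
    as-power : ∀ j → nonzero-element j ≈ ω^ toℕ (residue j)
    as-power j = trans (proj₂ (ω-gen (nonzero-element j) (nonzero-element-≉0 j)))
                       (trans (ω^-mod ω^m≈1 (exponent j)) (reflexive (≡.cong ω^_ (≡.sym (Finₚ.toℕ-fromℕ< (m%n<n (exponent j) m))))))
    residue-injective : ∀ {j j′} → residue j ≡ residue j′ → j ≡ j′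
    residue-injective {j} {j′} eq = nonzero-element-injective {j} {j′}
      (trans (as-power j) (trans (reflexive (≡.cong (λ r → ω^ toℕ r) eq)) (sym (as-power j′))))

  -- Two of ω^0, …, ω^L coincide, which gives a period of at most L.
  ω^L≈1 : ω^ L ≈ 1#
  ω^L≈1 with Finₚ.pigeonhole (ℕₚ.n<1+n L) (λ i → nonzero-index (ω^ toℕ i) (ω^≉0 (toℕ i)))
  ... | i , j , i<j , same-index = trans (reflexive (≡.cong ω^_ L≡j∸i)) ω^[j∸i]≈1
    where
    ω^[j∸i]≈1 : ω^ (toℕ j ∸ toℕ i) ≈ 1#
    ω^[j∸i]≈1 = ω^-∸ (ℕₚ.<⇒≤ i<j) (nonzero-index-injective (ω^≉0 (toℕ i)) (ω^≉0 (toℕ j)) same-index)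
    L≡j∸i : L ≡ toℕ j ∸ toℕ i
    L≡j∸i = ℕₚ.≤-antisym (order-lower-bound _ ⦃ ℕ.>-nonZero (ℕₚ.m<n⇒0<n∸m i<j) ⦄ ω^[j∸i]≈1)
                         (ℕₚ.≤-trans (ℕₚ.m∸n≤m (toℕ j) (toℕ i)) (ℕ.s≤s⁻¹ (Finₚ.toℕ<n j)))

  private
    shorter-period : ∀ {i j} → i ℕ.< j → j ℕ.< L → ω^ i ≉ ω^ j
    shorter-period {i} {j} i<j j<L ω^i≈ω^j = ℕₚ.<⇒≱ (ℕₚ.≤-<-trans (ℕₚ.m∸n≤m j i) j<L)
      (order-lower-bound (j ∸ i) ⦃ ℕ.>-nonZero (ℕₚ.m<n⇒0<n∸m i<j) ⦄ (ω^-∸ (ℕₚ.<⇒≤ i<j) ω^i≈ω^j))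

  ω^-injective : ∀ {i j} → i ℕ.< L → j ℕ.< L → ω^ i ≈ ω^ j → i ≡ j
  ω^-injective {i} {j} i<L j<L ω^i≈ω^j with ℕₚ.<-cmp i j
  ... | tri< i<j _ _ = ⊥-elim (shorter-period i<j j<L ω^i≈ω^j)
  ... | tri≈ _ i≡j _ = i≡j
  ... | tri> _ _ j<i = ⊥-elim (shorter-period j<i i<L (sym ω^i≈ω^j))

  private
    IsExponent : Carrier → Fin L → Set ℓ
    IsExponent x i = x ≈ ω^ toℕ i

    exponent-of : ∀ {x} → Dec (∃ (IsExponent x)) → Fin L
    exponent-of (yes (i , _)) = i
    exponent-of (no _)        = Fin.fromℕ< (ℕ.>-nonZero⁻¹ L)  -- junk value, reached only for 0#

    has-exponent : ∀ {x} → x ≉ 0# → ∃ (IsExponent x)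
    has-exponent {x} x≉0 with ω-gen x x≉0
    ... | n , x≈ω^n = n mod L , trans x≈ω^n (trans (ω^-mod ω^L≈1 n) (reflexive (≡.cong ω^_ (≡.sym (Finₚ.toℕ-fromℕ< (m%n<n n L))))))

  dlog : Carrier → Fin L
  dlog x = exponent-of (Finₚ.any? (λ i → x ≟ ω^ toℕ i))

  dlog-spec : ∀ {x} → x ≉ 0# → x ≈ ω^ toℕ (dlog x)
  dlog-spec {x} x≉0 = spec (Finₚ.any? (λ i → x ≟ ω^ toℕ i))
    where
    spec : (d : Dec (∃ (IsExponent x))) → IsExponent x (exponent-of d)
    spec (yes (_ , x≈ω^i)) = x≈ω^i
    spec (no ∄)            = ⊥-elim (∄ (has-exponent x≉0))

  dlog-unique : ∀ {x} i → x ≈ ω^ toℕ i → dlog x ≡ i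
  dlog-unique {x} i x≈ω^i = unique (Finₚ.any? (λ i → x ≟ ω^ toℕ i))
    where
    unique : (d : Dec (∃ (IsExponent x))) → exponent-of d ≡ i
    unique (yes (j , x≈ω^j)) = Finₚ.toℕ-injective (ω^-injective (Finₚ.toℕ<n j) (Finₚ.toℕ<n i) (trans (sym x≈ω^j) x≈ω^i))
    unique (no ∄)            = ⊥-elim (∄ (i , x≈ω^i))

  dlog-cong : ∀ {x y} → x ≈ y → dlog x ≡ dlog y
  dlog-cong {x} {y} x≈y with x ≟ 0#
  ... | no x≉0  = ≡.sym (dlog-unique _ (trans (sym x≈y) (dlog-spec x≉0)))
  ... | yes x≈0 = ≡.trans (junk x≈0) (≡.sym (junk (trans (sym x≈y) x≈0)))
    where
    junk : ∀ {z} → z ≈ 0# → dlog z ≡ Fin.fromℕ< (ℕ.>-nonZero⁻¹ L)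
    junk {z} z≈0 = no-exponent (Finₚ.any? (λ i → z ≟ ω^ toℕ i))
      where
      no-exponent : (d : Dec (∃ (IsExponent z))) → exponent-of d ≡ Fin.fromℕ< (ℕ.>-nonZero⁻¹ L)
      no-exponent (yes (i , z≈ω^i)) = ⊥-elim (ω^≉0 (toℕ i) (trans (sym z≈ω^i) z≈0))
      no-exponent (no _)            = ≡.refl

  toℕ-dlog-ω^ : ∀ n → toℕ (dlog (ω^ n)) ≡ n % L
  toℕ-dlog-ω^ n = ≡.trans (≡.cong toℕ (dlog-unique (n mod L) (trans (ω^-mod ω^L≈1 n) (reflexive (≡.cong ω^_ (≡.sym (Finₚ.toℕ-fromℕ< (m%n<n n L))))))))
                          (Finₚ.toℕ-fromℕ< (m%n<n n L))

  ∑-𝟙-powers : ∀ x → ∑[ i < L ] 𝟙 (x ≟ ω^ toℕ i) ≡ 𝟙 (¬? (x ≟ 0#))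
  ∑-𝟙-powers x with x ≟ 0#
  ... | yes x≈0 = ≡.trans (sum-cong-≗ {L} (λ i → 𝟙-no (λ x≈ω^i → ω^≉0 (toℕ i) (trans (sym x≈ω^i) x≈0)) {x ≟ ω^ toℕ i}))
                          (≡.trans (∑-const L 0ℤ) (ℤₚ.*-zeroʳ (+ L)))
  ... | no x≉0  = ≡.trans (sum-cong-≗ {L} (λ i → 𝟙-cong (mk⇔ (λ x≈ω^i → ≡.sym (dlog-unique i x≈ω^i))
                                                        (λ i≡dlog → trans (dlog-spec x≉0) (reflexive (≡.cong (λ j → ω^ toℕ j) (≡.sym i≡dlog)))))
                                                  {x ≟ ω^ toℕ i} {i Fin.≟ dlog x}))
                          (∑-δ (dlog x))

  ∑F-nonzero : ∀ (f : Carrier → ℤ) → f Preserves _≈_ ⟶ _≡_ →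
               ∑[ x ∈F ] (𝟙 (¬? (x ≟ 0#)) ℤ.* f x) ≡ ∑[ i < L ] f (ω^ toℕ i)
  ∑F-nonzero f f-cong = begin
    ∑[ x ∈F ] (𝟙 (¬? (x ≟ 0#)) ℤ.* f x)
      ≡⟨ ∑F-cong (λ x → ≡.trans (≡.cong (ℤ._* f x) (≡.sym (∑-𝟙-powers x))) (≡.sym (∑-*ʳ L (f x) (λ i → 𝟙 (x ≟ ω^ toℕ i))))) ⟩
    ∑[ x ∈F ] ∑[ i < L ] (𝟙 (x ≟ ω^ toℕ i) ℤ.* f x)
      ≡⟨ ∑-comm {suc L} {L} (λ j i → 𝟙 (enum j ≟ ω^ toℕ i) ℤ.* f (enum j)) ⟩
    ∑[ i < L ] ∑[ x ∈F ] (𝟙 (x ≟ ω^ toℕ i) ℤ.* f x)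
      ≡⟨ sum-cong-≗ {L} (λ i → ∑F-point f f-cong (ω^ toℕ i)) ⟩
    ∑[ i < L ] f (ω^ toℕ i) ∎
    where open ≡.≡-Reasoning

  private
    difference-of-squares : ∀ x → (x - 1#) * (x + 1#) ≈ x * x - 1#
    difference-of-squares = solve 1 (λ x → (x :- con (+ 1)) :* (x :+ con (+ 1)) := x :* x :- con (+ 1)) refl

  square≈1 : ∀ {x} → x * x ≈ 1# → x ≈ 1# ⊎ x ≈ -1#
  square≈1 {x} x²≈1 with zero-product (trans (difference-of-squares x) (x≈y⇒x∙y⁻¹≈ε x²≈1))
  ... | inj₁ x-1≈0 = inj₁ (x∙y⁻¹≈ε⇒x≈y x 1# x-1≈0)
  ... | inj₂ x+1≈0 = inj₂ (Equivalence.to +1≈0⇔≈-1 x+1≈0)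

  -1²≈1 : -1# * -1# ≈ 1#
  -1²≈1 = solve 0 (:- con (+ 1) :* :- con (+ 1) := con (+ 1)) refl

  -1≉0 : -1# ≉ 0#
  -1≉0 -1≈0 = 1≉0 (trans (sym -1²≈1) (trans (*-congˡ -1≈0) (zeroʳ -1#)))

  private
    half<L : ∀ h → L ≡ h ℕ.+ h → h ℕ.< L
    half<L zero    L≡0   = ⊥-elim (ℕ.≢-nonZero⁻¹ L L≡0)
    half<L (suc h) L≡h+h = ≡.subst (suc (suc h) ℕ.≤_) (≡.sym L≡h+h) (ℕ.s≤s (ℕₚ.m≤n+m (suc h) h))

  dlog-minus-one-even : ∀ h → L ≡ h ℕ.+ h → toℕ (dlog -1#) ≡ h
  dlog-minus-one-even h L≡h+h with square≈1 {ω^ h} (trans (sym (ω^-+ h h)) (trans (reflexive (≡.cong ω^_ (≡.sym L≡h+h))) ω^L≈1))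
  ... | inj₁ ω^h≈1  = ⊥-elim (ℕ.≢-nonZero⁻¹ L (≡.trans L≡h+h (≡.cong (λ n → n ℕ.+ n)
                        (ω^-injective (half<L h L≡h+h) (ℕ.>-nonZero⁻¹ L) ω^h≈1))))
  ... | inj₂ ω^h≈-1 = ≡.trans (≡.cong toℕ (dlog-unique (Fin.fromℕ< (half<L h L≡h+h)) -1≈ω^h)) (Finₚ.toℕ-fromℕ< (half<L h L≡h+h))
    where
    -1≈ω^h : -1# ≈ ω^ toℕ (Fin.fromℕ< (half<L h L≡h+h))
    -1≈ω^h = trans (sym ω^h≈-1) (reflexive (≡.cong ω^_ (≡.sym (Finₚ.toℕ-fromℕ< (half<L h L≡h+h)))))

  dlog-minus-one-odd : ∀ h → L ≡ suc (h ℕ.+ h) → toℕ (dlog -1#) ≡ 0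
  dlog-minus-one-odd h L≡2h+1 with multiple<double {d ℕ.+ d} {L} (ω^-injective (m%n<n (d ℕ.+ d) L) (ℕ.>-nonZero⁻¹ L) ω^[2d%L]≈1)
                                                   (ℕₚ.+-mono-< (Finₚ.toℕ<n (dlog -1#)) (Finₚ.toℕ<n (dlog -1#)))
    where
    d = toℕ (dlog -1#)
    ω^[2d%L]≈1 : ω^ ((d ℕ.+ d) % L) ≈ 1#
    ω^[2d%L]≈1 = trans (sym (ω^-mod ω^L≈1 (d ℕ.+ d)))
                   (trans (ω^-+ d d) (trans (sym (*-cong (dlog-spec -1≉0) (dlog-spec -1≉0))) -1²≈1))
  ... | inj₁ 2d≡0 = ℕₚ.m+n≡0⇒m≡0 (toℕ (dlog -1#)) 2d≡0
  ... | inj₂ 2d≡L = ⊥-elim (double≢odd (toℕ (dlog -1#)) h (≡.trans 2d≡L L≡2h+1))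

-- Cyclotomic classes and numbers

module Cyclotomic {c ℓ : Level} {L : ℕ} (F : FiniteFieldWithGenerator c ℓ (suc L)) (1<L : 1 ℕ.< L)
                 (e k : ℕ) ⦃ _ : NonZero e ⦄ (L≡k*e : L ≡ k ℕ.* e) where
  open FiniteFieldWithGenerator F
  open FieldAlgebra F
  open FieldSums F
  open DiscreteLog F 1<L
  open Cyclic e
  open LineSums e
  open IntegerCoefficients fieldRing using (solve; _:=_; _:+_; _:*_; :-_; _:-_; con)
  open ≡.≡-Reasoning

  κ : Carrier → Fin e
  κ x = toℕ (dlog x) mod e

  κ-cong : ∀ {x y} → x ≈ y → κ x ≡ κ y
  κ-cong x≈y = ≡.cong (λ i → toℕ i mod e) (dlog-cong x≈y)

  κ-ω^ : ∀ n → κ (ω^ n) ≡ n mod e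
  κ-ω^ n = Finₚ.toℕ-injective (begin
    toℕ (κ (ω^ n))        ≡⟨ toℕ-mod _ ⟩
    toℕ (dlog (ω^ n)) % e ≡⟨ ≡.cong (_% e) (toℕ-dlog-ω^ n) ⟩
    n % L % e             ≡⟨ m∣n⇒o%n%m≡o%m e L n (divides k L≡k*e) ⟩
    n % e                 ≡⟨ ≡.sym (toℕ-mod n) ⟩
    toℕ (n mod e)         ∎)

  κ-1 : κ 1# ≡ 𝟘
  κ-1 = κ-ω^ 0

  κ-* : ∀ {x y} → x ≉ 0# → y ≉ 0# → κ (x * y) ≡ κ x ⊕ κ y
  κ-* {x} {y} x≉0 y≉0 = begin
    κ (x * y)                 ≡⟨ κ-cong (trans (*-cong (dlog-spec x≉0) (dlog-spec y≉0)) (sym (ω^-+ dx dy))) ⟩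
    κ (ω^ (dx ℕ.+ dy))        ≡⟨ κ-ω^ (dx ℕ.+ dy) ⟩
    (dx ℕ.+ dy) mod e         ≡⟨ Finₚ.toℕ-injective (begin
      toℕ ((dx ℕ.+ dy) mod e)            ≡⟨ toℕ-mod (dx ℕ.+ dy) ⟩
      (dx ℕ.+ dy) % e                    ≡⟨ %-distribˡ-+ dx dy e ⟩
      (dx % e ℕ.+ dy % e) % e            ≡⟨ ≡.sym (≡.cong₂ (λ s t → (s ℕ.+ t) % e) (toℕ-mod dx) (toℕ-mod dy)) ⟩
      (toℕ (κ x) ℕ.+ toℕ (κ y)) % e      ≡⟨ ≡.sym (toℕ-⊕ (κ x) (κ y)) ⟩
      toℕ (κ x ⊕ κ y)                    ∎) ⟩
    κ x ⊕ κ y                 ∎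
    where
    dx = toℕ (dlog x)
    dy = toℕ (dlog y)

  InClass : Fin e → Carrier → Set ℓ
  InClass a x = x ≉ 0# × κ x ≡ a

  inClass? : ∀ a → Decidable (InClass a)
  inClass? a x = ¬? (x ≟ 0#) ×-dec (κ x Fin.≟ a)

  χ : Fin e → Carrier → ℤ
  χ a x = 𝟙 (inClass? a x)

  nonzero : Carrier → ℤ
  nonzero x = 𝟙 (¬? (x ≟ 0#))

  χ-cong : ∀ a → χ a Preserves _≈_ ⟶ _≡_
  χ-cong a {x} {y} x≈y = 𝟙-cong (mk⇔ (λ (x≉0 , κx≡a) → (x≉0 ∘ trans x≈y) , ≡.trans (κ-cong (sym x≈y)) κx≡a)
                                     (λ (y≉0 , κy≡a) → (y≉0 ∘ trans (sym x≈y)) , ≡.trans (κ-cong x≈y) κy≡a))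

  nonzero-cong : nonzero Preserves _≈_ ⟶ _≡_
  nonzero-cong x≈y = 𝟙-cong (mk⇔ (λ x≉0 → x≉0 ∘ trans x≈y) (λ y≉0 → y≉0 ∘ trans (sym x≈y)))

  nonzero-≉0 : ∀ {x} → x ≉ 0# → nonzero x ≡ 1ℤ
  nonzero-≉0 x≉0 = 𝟙-yes x≉0

  nonzero-≈0 : ∀ {x} → x ≈ 0# → nonzero x ≡ 0ℤ
  nonzero-≈0 x≈0 = 𝟙-no (λ x≉0 → x≉0 x≈0)

  χ-split : ∀ a x → χ a x ≡ nonzero x ℤ.* δ (κ x) a
  χ-split a x = 𝟙-× (¬? (x ≟ 0#)) (κ x Fin.≟ a)

  χ-≈0 : ∀ a {x} → x ≈ 0# → χ a x ≡ 0ℤ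
  χ-≈0 a x≈0 = 𝟙-no (λ (x≉0 , _) → x≉0 x≈0)

  χ-≉0 : ∀ a {x} → x ≉ 0# → χ a x ≡ δ (κ x) a
  χ-≉0 a {x} x≉0 = 𝟙-cong (mk⇔ proj₂ (x≉0 ,_))

  ∑-χ : ∀ x → ∑[ a < e ] χ a x ≡ nonzero x
  ∑-χ x = begin
    ∑[ a < e ] χ a x                      ≡⟨ sum-cong-≗ (λ a → χ-split a x) ⟩
    ∑[ a < e ] (nonzero x ℤ.* δ (κ x) a)  ≡⟨ ∑-*ˡ e (nonzero x) (δ (κ x)) ⟩
    nonzero x ℤ.* ∑[ a < e ] δ (κ x) a    ≡⟨ ≡.cong (nonzero x ℤ.*_) (≡.trans (sum-cong-≗ (δ-sym (κ x))) (∑-δ (κ x))) ⟩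
    nonzero x ℤ.* 1ℤ                      ≡⟨ ℤₚ.*-identityʳ (nonzero x) ⟩
    nonzero x                             ∎

  class-size : ∀ a → ∑[ x ∈F ] χ a x ≡ + k
  class-size a = begin
    ∑[ x ∈F ] χ a x                          ≡⟨ ∑F-cong (χ-split a) ⟩
    ∑[ x ∈F ] (nonzero x ℤ.* δ (κ x) a)      ≡⟨ ∑F-nonzero (λ x → δ (κ x) a) (λ x≈y → ≡.cong (λ i → δ i a) (κ-cong x≈y)) ⟩
    ∑[ i < L ] δ (κ (ω^ toℕ i)) a            ≡⟨ sum-cong-≗ {L} (λ i → ≡.cong (λ j → δ j a) (κ-ω^ (toℕ i))) ⟩
    ∑[ i < L ] δ (toℕ i mod e) a             ≡⟨ ≡.cong (λ n → ∑[ i < n ] δ (toℕ i mod e) a) L≡k*e ⟩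
    ∑[ i < k ℕ.* e ] δ (toℕ i mod e) a       ≡⟨ ∑-δ-mod k a ⟩
    + k                                      ∎

  InCoset⇔InClass : ∀ a x → InCoset e (toℕ a) x ⇔ InClass a x
  InCoset⇔InClass a x = mk⇔ to from
    where
    to : InCoset e (toℕ a) x → InClass a x
    to (j , x≈ω^n) = ω^≉0 (toℕ a ℕ.+ e ℕ.* toℕ j) ∘ trans (sym x≈ω^n) , ≡.trans (κ-cong x≈ω^n) (≡.trans (κ-ω^ (toℕ a ℕ.+ e ℕ.* toℕ j)) (Finₚ.toℕ-injective (begin
      toℕ ((toℕ a ℕ.+ e ℕ.* toℕ j) mod e)  ≡⟨ toℕ-mod _ ⟩
      (toℕ a ℕ.+ e ℕ.* toℕ j) % e          ≡⟨ ≡.cong (λ t → (toℕ a ℕ.+ t) % e) (ℕₚ.*-comm e (toℕ j)) ⟩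
      (toℕ a ℕ.+ toℕ j ℕ.* e) % e          ≡⟨ [m+kn]%n≡m%n (toℕ a) (toℕ j) e ⟩
      toℕ a % e                            ≡⟨ ≡.sym (toℕ-mod (toℕ a)) ⟩
      toℕ (toℕ a mod e)                    ≡⟨ ≡.cong toℕ (toℕ-mod-toℕ a) ⟩
      toℕ a                                ∎)))
    from : InClass a x → InCoset e (toℕ a) x
    from (x≉0 , κx≡a) = Fin.fromℕ< q<L , trans (dlog-spec x≉0) (reflexive (≡.cong ω^_ d≡a+e*q))
      where
      d = toℕ (dlog x)
      q<L : d / e ℕ.< L
      q<L = ℕₚ.≤-<-trans (m/n≤m d e) (Finₚ.toℕ<n (dlog x))
      d≡a+e*q : d ≡ toℕ a ℕ.+ e ℕ.* toℕ (Fin.fromℕ< q<L)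
      d≡a+e*q = begin
        d                                       ≡⟨ m≡m%n+[m/n]*n d e ⟩
        d % e ℕ.+ d / e ℕ.* e                   ≡⟨ ≡.cong₂ ℕ._+_ (≡.trans (≡.sym (toℕ-mod d)) (≡.cong toℕ κx≡a)) (ℕₚ.*-comm (d / e) e) ⟩
        toℕ a ℕ.+ e ℕ.* (d / e)                 ≡⟨ ≡.cong (λ q → toℕ a ℕ.+ e ℕ.* q) (≡.sym (Finₚ.toℕ-fromℕ< q<L)) ⟩
        toℕ a ℕ.+ e ℕ.* toℕ (Fin.fromℕ< q<L)    ∎

  cyc : Array
  cyc a b = + cyclotomic e (toℕ a) (toℕ b)

  cyc-∑F : ∀ a b → cyc a b ≡ ∑[ x ∈F ] (χ a x ℤ.* χ b (x + 1#))
  cyc-∑F a b = ≡.trans (length-filter (λ i → inCoset? e (toℕ a) (enum i) ×-dec inCoset? e (toℕ b) (enum i + 1#)) (λ i → i))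
    (sum-cong-≗ (λ i → ≡.trans (𝟙-× (inCoset? e (toℕ a) (enum i)) (inCoset? e (toℕ b) (enum i + 1#)))
                               (≡.cong₂ ℤ._*_ (𝟙-cong (InCoset⇔InClass a (enum i)) {inCoset? e (toℕ a) (enum i)} {inClass? a (enum i)})
                                              (𝟙-cong (InCoset⇔InClass b (enum i + 1#)) {inCoset? e (toℕ b) (enum i + 1#)} {inClass? b (enum i + 1#)}))))

  nonzero-+1 : ∀ x → nonzero (x + 1#) ≡ 𝟙 (¬? (x ≟ -1#))
  nonzero-+1 x = 𝟙-cong (mk⇔ (λ x+1≉0 → x+1≉0 ∘ Equivalence.from +1≈0⇔≈-1) (λ x≉-1 → x≉-1 ∘ Equivalence.to +1≈0⇔≈-1))

  cyc-rows : ∀ a → rowSum cyc a ≡ + k ℤ.- δ a (κ -1#)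
  cyc-rows a = begin
    ∑[ b < e ] cyc a b
      ≡⟨ sum-cong-≗ (cyc-∑F a) ⟩
    ∑[ b < e ] ∑[ x ∈F ] (χ a x ℤ.* χ b (x + 1#))
      ≡⟨ ∑-comm (λ b i → χ a (enum i) ℤ.* χ b (enum i + 1#)) ⟩
    ∑[ x ∈F ] ∑[ b < e ] (χ a x ℤ.* χ b (x + 1#))
      ≡⟨ ∑F-cong (λ x → ≡.trans (∑-*ˡ e (χ a x) (λ b → χ b (x + 1#))) (≡.cong (χ a x ℤ.*_) (∑-χ (x + 1#)))) ⟩
    ∑[ x ∈F ] (χ a x ℤ.* nonzero (x + 1#))
      ≡⟨ ∑F-cong (λ x → ≡.trans (ℤₚ.*-comm (χ a x) (nonzero (x + 1#))) (≡.cong (ℤ._* χ a x) (nonzero-+1 x))) ⟩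
    ∑[ x ∈F ] (𝟙 (¬? (x ≟ -1#)) ℤ.* χ a x)
      ≡⟨ ∑F-punctured (χ a) (χ-cong a) -1# ⟩
    ∑F (χ a) ℤ.- χ a -1#
      ≡⟨ ≡.cong₂ ℤ._-_ (class-size a) (≡.trans (χ-≉0 a -1≉0) (δ-sym (κ -1#) a)) ⟩
    + k ℤ.- δ a (κ -1#) ∎

  cyc-cols : ∀ b → colSum cyc b ≡ + k ℤ.- δ b 𝟘
  cyc-cols b = begin
    ∑[ a < e ] cyc a b
      ≡⟨ sum-cong-≗ (λ a → cyc-∑F a b) ⟩
    ∑[ a < e ] ∑[ x ∈F ] (χ a x ℤ.* χ b (x + 1#))
      ≡⟨ ∑-comm (λ a i → χ a (enum i) ℤ.* χ b (enum i + 1#)) ⟩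
    ∑[ x ∈F ] ∑[ a < e ] (χ a x ℤ.* χ b (x + 1#))
      ≡⟨ ∑F-cong (λ x → ≡.trans (∑-*ʳ e (χ b (x + 1#)) (λ a → χ a x)) (≡.cong (ℤ._* χ b (x + 1#)) (∑-χ x))) ⟩
    ∑[ x ∈F ] (nonzero x ℤ.* χ b (x + 1#))
      ≡⟨ ∑F-reindex (λ x → ¬? (x ≟ 0#)) (λ y → ¬? (y ≟ 1#)) (_+ 1#) (_- 1#) forward backward (χ b) (χ-cong b) ⟩
    ∑[ y ∈F ] (𝟙 (¬? (y ≟ 1#)) ℤ.* χ b y)
      ≡⟨ ∑F-punctured (χ b) (χ-cong b) 1# ⟩
    ∑F (χ b) ℤ.- χ b 1#
      ≡⟨ ≡.cong₂ ℤ._-_ (class-size b) (≡.trans (χ-≉0 b 1≉0) (≡.trans (≡.cong (λ i → δ i b) κ-1) (δ-sym 𝟘 b))) ⟩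
    + k ℤ.- δ b 𝟘 ∎
    where
    +1-1 : ∀ x → x + 1# - 1# ≈ x
    +1-1 = solve 1 (λ x → x :+ con (+ 1) :- con (+ 1) := x) refl
    -1+1 : ∀ y → y - 1# + 1# ≈ y
    -1+1 = solve 1 (λ y → y :- con (+ 1) :+ con (+ 1) := y) refl
    forward : ∀ {x y} → x ≉ 0# → y ≈ x + 1# → y ≉ 1# × x ≈ y - 1#
    forward {x} {y} x≉0 y≈x+1 = (λ y≈1 → x≉0 (trans (sym (+1-1 x)) (trans (+-congʳ (trans (sym y≈x+1) y≈1)) (-‿inverseʳ 1#))))
                               , trans (sym (+1-1 x)) (+-congʳ (sym y≈x+1))
    backward : ∀ {y x} → y ≉ 1# → x ≈ y - 1# → x ≉ 0# × y ≈ x + 1#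
    backward {y} {x} y≉1 x≈y-1 = (λ x≈0 → y≉1 (trans (sym (-1+1 y)) (trans (+-congʳ (trans (sym x≈y-1) x≈0)) (+-identityˡ 1#))))
                                , trans (sym (-1+1 y)) (+-congʳ (sym x≈y-1))

  InClass-* : ∀ {u} → u ≉ 0# → ∀ a s → InClass (a ⊕ κ u) (s * u) ⇔ InClass a s
  InClass-* {u} u≉0 a s = mk⇔
    (λ (su≉0 , κsu≡a⊕κu) → let s≉0 = λ s≈0 → su≉0 (trans (*-congʳ s≈0) (zeroˡ u)) in
                           s≉0 , ⊕-cancelʳ (κ u) (≡.trans (≡.sym (κ-* s≉0 u≉0)) κsu≡a⊕κu))
    (λ (s≉0 , κs≡a) → *-≉0 s≉0 u≉0 , ≡.trans (κ-* s≉0 u≉0) (≡.cong (_⊕ κ u) κs≡a))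

  χ-* : ∀ {u} → u ≉ 0# → ∀ a s → χ (a ⊕ κ u) (s * u) ≡ χ a s
  χ-* u≉0 a s = 𝟙-cong (InClass-* u≉0 a s)

  -- Under x ↦ x / (x + 1) the condition κ x ≡ κ (x + 1) ⊕ d becomes: the image lies in class d.
  cyc-diags : ∀ d → diagSum cyc d ≡ + k ℤ.- δ d 𝟘
  cyc-diags d = begin
    ∑[ j < e ] cyc (j ⊕ d) j
      ≡⟨ sum-cong-≗ (λ j → cyc-∑F (j ⊕ d) j) ⟩
    ∑[ j < e ] ∑[ x ∈F ] (χ (j ⊕ d) x ℤ.* χ j (x + 1#))
      ≡⟨ ∑-comm (λ j i → χ (j ⊕ d) (enum i) ℤ.* χ j (enum i + 1#)) ⟩
    ∑[ x ∈F ] ∑[ j < e ] (χ (j ⊕ d) x ℤ.* χ j (x + 1#))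
      ≡⟨ ∑F-cong diagonal-term ⟩
    ∑[ x ∈F ] (𝟙 (¬? (x ≟ -1#)) ℤ.* χ d (μ x))
      ≡⟨ möbius-reindex 1# 0# 1≉0 (χ d) (χ-cong d) ⟩
    ∑[ s ∈F ] (𝟙 (¬? (s ≟ 1#)) ℤ.* χ d s)
      ≡⟨ ∑F-punctured (χ d) (χ-cong d) 1# ⟩
    ∑F (χ d) ℤ.- χ d 1#
      ≡⟨ ≡.cong₂ ℤ._-_ (class-size d) (≡.trans (χ-≉0 d 1≉0) (≡.trans (≡.cong (λ i → δ i d) κ-1) (δ-sym 𝟘 d))) ⟩
    + k ℤ.- δ d 𝟘 ∎
    where
    μ : Carrier → Carrier
    μ x = (1# * x + 0#) * (x + 1#) ⁻¹

    pick-class : ∀ x → ∑[ j < e ] (χ (j ⊕ d) x ℤ.* χ j (x + 1#)) ≡ nonzero (x + 1#) ℤ.* χ (κ (x + 1#) ⊕ d) x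
    pick-class x = begin
      ∑[ j < e ] (χ (j ⊕ d) x ℤ.* χ j (x + 1#))
        ≡⟨ sum-cong-≗ (λ j → ≡.trans (≡.cong (χ (j ⊕ d) x ℤ.*_) (χ-split j (x + 1#)))
                                     (≡.trans (reorder (χ (j ⊕ d) x) (nonzero (x + 1#)) (δ (κ (x + 1#)) j))
                                              (≡.cong (ℤ._* (nonzero (x + 1#) ℤ.* χ (j ⊕ d) x)) (δ-sym (κ (x + 1#)) j)))) ⟩
      ∑[ j < e ] (δ j (κ (x + 1#)) ℤ.* (nonzero (x + 1#) ℤ.* χ (j ⊕ d) x))
        ≡⟨ ∑-δˡ (κ (x + 1#)) (λ j → nonzero (x + 1#) ℤ.* χ (j ⊕ d) x) ⟩
      nonzero (x + 1#) ℤ.* χ (κ (x + 1#) ⊕ d) x ∎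
      where
      reorder : ∀ a b c → a ℤ.* (b ℤ.* c) ≡ c ℤ.* (b ℤ.* a)
      reorder = ZSolver.solve-∀

    diagonal-term : ∀ x → ∑[ j < e ] (χ (j ⊕ d) x ℤ.* χ j (x + 1#)) ≡ 𝟙 (¬? (x ≟ -1#)) ℤ.* χ d (μ x)
    diagonal-term x with x ≟ -1#
    ... | yes x≈-1 = ≡.trans (pick-class x) (≡.cong (ℤ._* χ (κ (x + 1#) ⊕ d) x)
                       (nonzero-≈0 (Equivalence.from +1≈0⇔≈-1 x≈-1)))
    ... | no x≉-1  = ≡.trans (pick-class x) (≡.cong₂ ℤ._*_ (nonzero-≉0 x+1≉0) (begin
      χ (κ (x + 1#) ⊕ d) x              ≡⟨ ≡.cong (λ a → χ a x) (⊕-comm (κ (x + 1#)) d) ⟩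
      χ (d ⊕ κ (x + 1#)) x              ≡⟨ χ-cong (d ⊕ κ (x + 1#)) x≈μx*[x+1] ⟩
      χ (d ⊕ κ (x + 1#)) (μ x * (x + 1#)) ≡⟨ χ-* x+1≉0 d (μ x) ⟩
      χ d (μ x)                         ∎))
      where
      x+1≉0 : x + 1# ≉ 0#
      x+1≉0 = x≉-1 ∘ Equivalence.to +1≈0⇔≈-1
      x≈μx*[x+1] : x ≈ μ x * (x + 1#)
      x≈μx*[x+1] = sym (trans (Equivalence.to (≈-*⁻¹ x+1≉0) refl) (trans (+-identityʳ (1# * x)) (*-identityˡ x)))

  InClass-resp : ∀ a {x y} → x ≈ y → InClass a x → InClass a y
  InClass-resp a x≈y (x≉0 , κx≡a) = x≉0 ∘ trans x≈y , ≡.trans (κ-cong (sym x≈y)) κx≡a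

  same : Carrier → Carrier → ℤ
  same u v = ∑[ a < e ] (χ a u ℤ.* χ a v)

  same-cong : ∀ {u u′ v v′} → u ≈ u′ → v ≈ v′ → same u v ≡ same u′ v′
  same-cong u≈u′ v≈v′ = sum-cong-≗ (λ a → ≡.cong₂ ℤ._*_ (χ-cong a u≈u′) (χ-cong a v≈v′))

  same-≈0 : ∀ {u} v → u ≈ 0# → same u v ≡ 0ℤ
  same-≈0 v u≈0 = ≡.trans (sum-cong-≗ (λ a → ≡.cong (ℤ._* χ a v) (χ-≈0 a u≈0)))
                          (≡.trans (∑-const e 0ℤ) (ℤₚ.*-zeroʳ E))

  same-≉0 : ∀ {u} v → u ≉ 0# → same u v ≡ χ (κ u) v
  same-≉0 {u} v u≉0 = ≡.trans (sum-cong-≗ (λ a → ≡.cong (ℤ._* χ a v) (≡.trans (χ-≉0 a u≉0) (δ-sym (κ u) a))))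
                              (∑-δˡ (κ u) (λ a → χ a v))

  same-* : ∀ {u} s → u ≉ 0# → same u (s * u) ≡ χ 𝟘 s
  same-* {u} s u≉0 = ≡.trans (same-≉0 (s * u) u≉0)
                             (≡.trans (≡.cong (λ a → χ a (s * u)) (≡.sym (⊕-identityˡ (κ u)))) (χ-* u≉0 𝟘 s))

  same-self : ∀ u → same u u ≡ nonzero u
  same-self u = by-cases (u ≟ 0#)
    where
    by-cases : Dec (u ≈ 0#) → same u u ≡ nonzero u
    by-cases (yes u≈0) = ≡.trans (same-≈0 u u≈0) (≡.sym (nonzero-≈0 u≈0))
    by-cases (no u≉0)  = ≡.trans (same-≉0 u u≉0) (≡.trans (χ-≉0 (κ u) u≉0) (≡.trans (δ-refl (κ u)) (≡.sym (nonzero-≉0 u≉0))))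

  nonzero-count : ∑F nonzero ≡ + L
  nonzero-count = begin
    ∑[ x ∈F ] nonzero x               ≡⟨ ∑F-cong (λ x → ≡.sym (ℤₚ.*-identityʳ (nonzero x))) ⟩
    ∑[ x ∈F ] (nonzero x ℤ.* 1ℤ)      ≡⟨ ∑F-nonzero (λ _ → 1ℤ) (λ _ → ≡.refl) ⟩
    ∑[ i < L ] 1ℤ                     ≡⟨ ∑-const L 1ℤ ⟩
    + L ℤ.* 1ℤ                        ≡⟨ ℤₚ.*-identityʳ (+ L) ⟩
    + L                               ∎

  χ𝟘-1 : χ 𝟘 1# ≡ 1ℤ
  χ𝟘-1 = ≡.trans (χ-≉0 𝟘 1≉0) (≡.trans (≡.cong (λ i → δ i 𝟘) κ-1) (δ-refl 𝟘))

  same-expansion : ⟨ cyc , cyc ⟩ ≡ ∑[ x ∈F ] ∑[ y ∈F ] (same x y ℤ.* same (x + 1#) (y + 1#))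
  same-expansion = ≡.trans (sum-cong-≗ (λ a → sum-cong-≗ (λ b → ≡.cong₂ ℤ._*_ (cyc-∑F a b) (cyc-∑F a b))))
                           (∑∑-square (λ a i → χ a (enum i)) (λ b i → χ b (enum i + 1#)))

  Φ : Carrier → ℤ
  Φ t = ∑[ x ∈F ] (nonzero x ℤ.* same (x + 1#) (t * x + 1#))

  Φ-cong : Φ Preserves _≈_ ⟶ _≡_
  Φ-cong {t} {t′} t≈t′ = ∑F-cong (λ x → ≡.cong (nonzero x ℤ.*_) (same-cong {x + 1#} {x + 1#} {t * x + 1#} {t′ * x + 1#} refl (+-congʳ (*-congʳ t≈t′))))

  substitute-ratio : ∀ x → ∑[ y ∈F ] (same x y ℤ.* same (x + 1#) (y + 1#))
                     ≡ nonzero x ℤ.* ∑[ t ∈F ] (χ 𝟘 t ℤ.* same (x + 1#) (t * x + 1#))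
  substitute-ratio x = by-cases (x ≟ 0#)
    where
    G : Carrier → ℤ
    G y = same (x + 1#) (y + 1#)

    G-cong : G Preserves _≈_ ⟶ _≡_
    G-cong y≈y′ = same-cong refl (+-congʳ y≈y′)

    by-cases : Dec (x ≈ 0#) → ∑[ y ∈F ] (same x y ℤ.* G y) ≡ nonzero x ℤ.* ∑[ t ∈F ] (χ 𝟘 t ℤ.* G (t * x))
    by-cases (yes x≈0) = begin
      ∑[ y ∈F ] (same x y ℤ.* G y)   ≡⟨ ∑F-cong (λ y → ≡.cong (ℤ._* G y) (same-≈0 y x≈0)) ⟩
      ∑[ y ∈F ] 0ℤ                   ≡⟨ ≡.trans (∑-const (suc L) 0ℤ) (ℤₚ.*-zeroʳ (+ suc L)) ⟩
      0ℤ                             ≡⟨ ≡.cong (ℤ._* ∑[ t ∈F ] (χ 𝟘 t ℤ.* G (t * x))) (≡.sym (nonzero-≈0 x≈0)) ⟩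
      nonzero x ℤ.* ∑[ t ∈F ] (χ 𝟘 t ℤ.* G (t * x)) ∎
    by-cases (no x≉0) = begin
      ∑[ y ∈F ] (same x y ℤ.* G y)         ≡⟨ ∑F-cong (λ y → ≡.cong (ℤ._* G y) (same-≉0 y x≉0)) ⟩
      ∑[ y ∈F ] (χ (κ x) y ℤ.* G y)        ≡⟨ ≡.sym (∑F-reindex (inClass? 𝟘) (inClass? (κ x)) (_* x) (_* x ⁻¹) fwd bwd G G-cong) ⟩
      ∑[ t ∈F ] (χ 𝟘 t ℤ.* G (t * x))      ≡⟨ ≡.sym (ℤₚ.*-identityˡ _) ⟩
      1ℤ ℤ.* ∑[ t ∈F ] (χ 𝟘 t ℤ.* G (t * x)) ≡⟨ ≡.cong (ℤ._* ∑[ t ∈F ] (χ 𝟘 t ℤ.* G (t * x))) (≡.sym (nonzero-≉0 x≉0)) ⟩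
      nonzero x ℤ.* ∑[ t ∈F ] (χ 𝟘 t ℤ.* G (t * x)) ∎
      where
      in-class-of-x : ∀ {t} → InClass 𝟘 t ⇔ InClass (κ x) (t * x)
      in-class-of-x {t} = mk⇔ (≡.subst (λ a → InClass a (t * x)) (⊕-identityˡ (κ x)) ∘ Equivalence.from (InClass-* x≉0 𝟘 t))
                              (Equivalence.to (InClass-* x≉0 𝟘 t) ∘ ≡.subst (λ a → InClass a (t * x)) (≡.sym (⊕-identityˡ (κ x))))
      fwd : ∀ {t y} → InClass 𝟘 t → y ≈ t * x → InClass (κ x) y × t ≈ y * x ⁻¹
      fwd t∈C₀ y≈tx = InClass-resp (κ x) (sym y≈tx) (Equivalence.to in-class-of-x t∈C₀)
                   , Equivalence.from (≈-*⁻¹ x≉0) (sym y≈tx)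
      bwd : ∀ {y t} → InClass (κ x) y → t ≈ y * x ⁻¹ → InClass 𝟘 t × y ≈ t * x
      bwd y∈C t≈y/x = Equivalence.from in-class-of-x (InClass-resp (κ x) (sym tx≈y) y∈C) , sym tx≈y
        where
        tx≈y = Equivalence.to (≈-*⁻¹ x≉0) t≈y/x

  Φ-1 : Φ 1# ≡ + L ℤ.- 1ℤ
  Φ-1 = begin
    ∑[ x ∈F ] (nonzero x ℤ.* same (x + 1#) (1# * x + 1#))
      ≡⟨ ∑F-cong (λ x → ≡.cong (nonzero x ℤ.*_) (≡.trans (same-cong refl (+-congʳ (*-identityˡ x))) (same-self (x + 1#)))) ⟩
    ∑[ x ∈F ] (nonzero x ℤ.* nonzero (x + 1#))
      ≡⟨ ∑F-cong (λ x → ≡.trans (ℤₚ.*-comm (nonzero x) (nonzero (x + 1#))) (≡.cong (ℤ._* nonzero x) (nonzero-+1 x))) ⟩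
    ∑[ x ∈F ] (𝟙 (¬? (x ≟ -1#)) ℤ.* nonzero x)
      ≡⟨ ∑F-punctured nonzero nonzero-cong -1# ⟩
    ∑F nonzero ℤ.- nonzero -1#
      ≡⟨ ≡.cong₂ ℤ._-_ nonzero-count (nonzero-≉0 -1≉0) ⟩
    + L ℤ.- 1ℤ ∎

  Φ-in-C₀ : ∀ {t} → InClass 𝟘 t → t ≉ 1# → Φ t ≡ + k ℤ.- + 2
  Φ-in-C₀ {t} t∈C₀ t≉1 = begin
    ∑[ x ∈F ] (nonzero x ℤ.* same (x + 1#) (t * x + 1#))
      ≡⟨ ∑F-punctured (λ x → same (x + 1#) (t * x + 1#)) (λ x≈y → same-cong (+-congʳ x≈y) (+-congʳ (*-congˡ x≈y))) 0# ⟩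
    ∑[ x ∈F ] same (x + 1#) (t * x + 1#) ℤ.- same (0# + 1#) (t * 0# + 1#)
      ≡⟨ ≡.cong₂ ℤ._-_ (∑F-cong möbius-form) (≡.trans (same-cong (+-identityˡ 1#) (trans (+-congʳ (zeroʳ t)) (+-identityˡ 1#)))
                                                      (≡.trans (same-self 1#) (nonzero-≉0 1≉0))) ⟩
    ∑[ x ∈F ] (𝟙 (¬? (x ≟ -1#)) ℤ.* χ 𝟘 ((t * x + 1#) * (x + 1#) ⁻¹)) ℤ.- 1ℤ
      ≡⟨ ≡.cong (ℤ._- 1ℤ) (möbius-reindex t 1# t≉1 (χ 𝟘) (χ-cong 𝟘)) ⟩
    ∑[ s ∈F ] (𝟙 (¬? (s ≟ t)) ℤ.* χ 𝟘 s) ℤ.- 1ℤ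
      ≡⟨ ≡.cong (ℤ._- 1ℤ) (∑F-punctured (χ 𝟘) (χ-cong 𝟘) t) ⟩
    ∑F (χ 𝟘) ℤ.- χ 𝟘 t ℤ.- 1ℤ
      ≡⟨ ≡.cong₂ (λ s u → s ℤ.- u ℤ.- 1ℤ) (class-size 𝟘) (𝟙-yes t∈C₀) ⟩
    + k ℤ.- 1ℤ ℤ.- 1ℤ
      ≡⟨ minus-two (+ k) ⟩
    + k ℤ.- + 2 ∎
    where
    minus-two : ∀ K → K ℤ.- 1ℤ ℤ.- 1ℤ ≡ K ℤ.- + 2
    minus-two = ZSolver.solve-∀
    möbius-form : ∀ x → same (x + 1#) (t * x + 1#) ≡ 𝟙 (¬? (x ≟ -1#)) ℤ.* χ 𝟘 ((t * x + 1#) * (x + 1#) ⁻¹)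
    möbius-form x with x ≟ -1#
    ... | yes x≈-1 = same-≈0 (t * x + 1#) (Equivalence.from +1≈0⇔≈-1 x≈-1)
    ... | no x≉-1  = ≡.trans (same-cong refl (sym (Equivalence.to (≈-*⁻¹ x+1≉0) refl)))
                             (≡.trans (same-* ((t * x + 1#) * (x + 1#) ⁻¹) x+1≉0) (≡.sym (ℤₚ.*-identityˡ _)))
      where
      x+1≉0 : x + 1# ≉ 0#
      x+1≉0 = x≉-1 ∘ Equivalence.to +1≈0⇔≈-1

  -- The pairs (x , y) with x ~ y and x + 1 ~ y + 1 are enumerated by x and the ratio t = y / x ∈ C₀.
  cyc-squares : ⟨ cyc , cyc ⟩ ≡ E ℤ.* + k ℤ.- 1ℤ ℤ.+ (+ k ℤ.- 1ℤ) ℤ.* (+ k ℤ.- + 2)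
  cyc-squares = begin
    ⟨ cyc , cyc ⟩
      ≡⟨ same-expansion ⟩
    ∑[ x ∈F ] ∑[ y ∈F ] (same x y ℤ.* same (x + 1#) (y + 1#))
      ≡⟨ ∑F-cong substitute-ratio ⟩
    ∑[ x ∈F ] (nonzero x ℤ.* ∑[ t ∈F ] (χ 𝟘 t ℤ.* S x t))
      ≡⟨ exchange ⟩
    ∑[ t ∈F ] (χ 𝟘 t ℤ.* Φ t)
      ≡⟨ ∑F-split (λ t → χ 𝟘 t ℤ.* Φ t) (λ t≈t′ → ≡.cong₂ ℤ._*_ (χ-cong 𝟘 t≈t′) (Φ-cong t≈t′)) 1# ⟩
    χ 𝟘 1# ℤ.* Φ 1# ℤ.+ ∑[ t ∈F ] (𝟙 (¬? (t ≟ 1#)) ℤ.* (χ 𝟘 t ℤ.* Φ t))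
      ≡⟨ ≡.cong₂ ℤ._+_ (≡.cong₂ ℤ._*_ χ𝟘-1 Φ-1) (∑F-cong (λ t → off-one t (t ≟ 1#) (inClass? 𝟘 t))) ⟩
    1ℤ ℤ.* (+ L ℤ.- 1ℤ) ℤ.+ ∑[ t ∈F ] (𝟙 (¬? (t ≟ 1#)) ℤ.* χ 𝟘 t ℤ.* (+ k ℤ.- + 2))
      ≡⟨ ≡.cong (ℤ._+_ (1ℤ ℤ.* (+ L ℤ.- 1ℤ))) (∑-*ʳ (suc L) (+ k ℤ.- + 2) (λ i → 𝟙 (¬? (enum i ≟ 1#)) ℤ.* χ 𝟘 (enum i))) ⟩
    1ℤ ℤ.* (+ L ℤ.- 1ℤ) ℤ.+ ∑[ t ∈F ] (𝟙 (¬? (t ≟ 1#)) ℤ.* χ 𝟘 t) ℤ.* (+ k ℤ.- + 2)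
      ≡⟨ ≡.cong₂ (λ n s → 1ℤ ℤ.* (n ℤ.- 1ℤ) ℤ.+ s ℤ.* (+ k ℤ.- + 2))
                 (≡.trans (≡.cong +_ L≡k*e) (≡.trans (ℤₚ.pos-* k e) (ℤₚ.*-comm (+ k) E)))
                 (≡.trans (∑F-punctured (χ 𝟘) (χ-cong 𝟘) 1#) (≡.cong₂ ℤ._-_ (class-size 𝟘) χ𝟘-1)) ⟩
    1ℤ ℤ.* (E ℤ.* + k ℤ.- 1ℤ) ℤ.+ (+ k ℤ.- 1ℤ) ℤ.* (+ k ℤ.- + 2)
      ≡⟨ ≡.cong (ℤ._+ (+ k ℤ.- 1ℤ) ℤ.* (+ k ℤ.- + 2)) (ℤₚ.*-identityˡ (E ℤ.* + k ℤ.- 1ℤ)) ⟩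
    E ℤ.* + k ℤ.- 1ℤ ℤ.+ (+ k ℤ.- 1ℤ) ℤ.* (+ k ℤ.- + 2) ∎
    where
    S : Carrier → Carrier → ℤ
    S x t = same (x + 1#) (t * x + 1#)

    exchange : ∑[ x ∈F ] (nonzero x ℤ.* ∑[ t ∈F ] (χ 𝟘 t ℤ.* S x t)) ≡ ∑[ t ∈F ] (χ 𝟘 t ℤ.* Φ t)
    exchange = begin
      ∑[ x ∈F ] (nonzero x ℤ.* ∑[ t ∈F ] (χ 𝟘 t ℤ.* S x t))
        ≡⟨ ∑F-cong (λ x → ≡.sym (∑F-*ˡ (nonzero x) (λ t → χ 𝟘 t ℤ.* S x t))) ⟩
      ∑[ x ∈F ] ∑[ t ∈F ] (nonzero x ℤ.* (χ 𝟘 t ℤ.* S x t))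
        ≡⟨ ∑F-comm (λ x t → nonzero x ℤ.* (χ 𝟘 t ℤ.* S x t)) ⟩
      ∑[ t ∈F ] ∑[ x ∈F ] (nonzero x ℤ.* (χ 𝟘 t ℤ.* S x t))
        ≡⟨ ∑F-cong (λ t → ≡.trans (∑F-cong (λ x → swap (nonzero x) (χ 𝟘 t) (S x t))) (∑F-*ˡ (χ 𝟘 t) (λ x → nonzero x ℤ.* S x t))) ⟩
      ∑[ t ∈F ] (χ 𝟘 t ℤ.* Φ t) ∎
      where
      swap : ∀ a b c → a ℤ.* (b ℤ.* c) ≡ b ℤ.* (a ℤ.* c)
      swap = ZSolver.solve-∀

    off-one : ∀ t (d : Dec (t ≈ 1#)) (h : Dec (InClass 𝟘 t)) →
              𝟙 (¬? d) ℤ.* (𝟙 h ℤ.* Φ t) ≡ 𝟙 (¬? d) ℤ.* 𝟙 h ℤ.* (+ k ℤ.- + 2)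
    off-one t (yes _)   _          = ≡.refl
    off-one t (no _)    (no _)     = ≡.refl
    off-one t (no t≉1) (yes t∈C₀)  = ≡.trans (≡.cong (λ z → 1ℤ ℤ.* (1ℤ ℤ.* z)) (Φ-in-C₀ t∈C₀ t≉1)) (≡.sym (ℤₚ.*-assoc 1ℤ 1ℤ _))

-- Fields with q ^ r elements

geometric : ℕ → ℕ → ℕ
geometric q zero    = 0
geometric q (suc r) = 1 ℕ.+ q ℕ.* geometric q r

pow≡1+geometric*e : ∀ e r → suc e ^ r ≡ suc (geometric (suc e) r ℕ.* e)
pow≡1+geometric*e e zero    = ≡.refl
pow≡1+geometric*e e (suc r) = ≡.trans (≡.cong (suc e ℕ.*_) (pow≡1+geometric*e e r)) (expand e (geometric (suc e) r))
  where
  expand : ∀ e g → suc e ℕ.* suc (g ℕ.* e) ≡ suc ((1 ℕ.+ suc e ℕ.* g) ℕ.* e)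
  expand = NSolver.solve-∀

isEven-even : ∀ {n} → n % 2 ≡ 0 → isEven n ≡ true
isEven-even n%2≡0 = ≡.cong (_≡ᵇ 0) n%2≡0

isEven-odd : ∀ {n} → n % 2 ≡ 1 → isEven n ≡ false
isEven-odd n%2≡1 = ≡.cong (_≡ᵇ 0) n%2≡1

≡ᵇ-cong : ∀ {m n m′ n′} → (m ≡ n ⇔ m′ ≡ n′) → (m ≡ᵇ n) ≡ (m′ ≡ᵇ n′)
≡ᵇ-cong {m} {n} {m′} {n′} iff = does-cong (m ℕ.≟ n) (m′ ℕ.≟ n′) iff
  where
  does-cong : ∀ {a b} {A : Set a} {B : Set b} (d : Dec A) (d′ : Dec B) → A ⇔ B → does d ≡ does d′
  does-cong (yes _) (yes _)  _   = ≡.refl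
  does-cong (no _)  (no _)   _   = ≡.refl
  does-cong (yes a) (no ¬b)  A⇔B = ⊥-elim (¬b (Equivalence.to A⇔B a))
  does-cong (no ¬a) (yes b)  A⇔B = ⊥-elim (¬a (Equivalence.from A⇔B b))

geometric-pos : ∀ q r → 1 ≤ r → 1 ≤ geometric q r
geometric-pos q (suc r) _ = s≤s z≤n

A-condition : ∀ (R Q X Y : Bool) → (R ∧ X) ∨ (not R ∧ Q ∧ X) ∨ (not R ∧ not Q ∧ Y) ≡ (if R ∨ Q then X else Y)
A-condition true  Q     X Y = Boolₚ.∨-identityʳ X
A-condition false true  X Y = Boolₚ.∨-identityʳ X
A-condition false false X Y = ≡.refl

correction-term : ∀ e′ m n → (if m ≡ᵇ n then ℤ.- (+ e′) else + 1) ≡ 1ℤ ℤ.- + suc e′ ℤ.* 𝟙 (m ℕ.≟ n)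
correction-term e′ m n = by-cases (m ℕ.≟ n)
  where
  by-cases : ∀ {p} {P : Set p} (d : Dec P) → (if does d then ℤ.- (+ e′) else + 1) ≡ 1ℤ ℤ.- + suc e′ ℤ.* 𝟙 d
  by-cases (yes _) = minus (+ e′)
    where
    minus : ∀ x → ℤ.- x ≡ 1ℤ ℤ.- (1ℤ ℤ.+ x) ℤ.* 1ℤ
    minus = ZSolver.solve-∀
  by-cases (no _)  = unchanged (+ e′)
    where
    unchanged : ∀ x → + 1 ≡ 1ℤ ℤ.- (1ℤ ℤ.+ x) ℤ.* 0ℤ
    unchanged = ZSolver.solve-∀

%2≡0⊎%2≡1 : ∀ n → n % 2 ≡ 0 ⊎ n % 2 ≡ 1
%2≡0⊎%2≡1 n with n % 2 | m%n<n n 2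
... | 0           | _               = inj₁ ≡.refl
... | 1           | _               = inj₂ ≡.refl
... | suc (suc _) | s≤s (s≤s ())

halves : ∀ n → n ≡ n % 2 ℕ.+ (n / 2 ℕ.+ n / 2)
halves n = ≡.trans (m≡m%n+[m/n]*n n 2) (≡.cong (n % 2 ℕ.+_) (twice (n / 2)))
  where
  twice : ∀ h → h ℕ.* 2 ≡ h ℕ.+ h
  twice = NSolver.solve-∀

geometric-odd : ∀ q r → q % 2 ≡ 0 → geometric q (suc r) % 2 ≡ 1
geometric-odd q r q%2≡0 = begin
  (1 ℕ.+ q ℕ.* g) % 2                      ≡⟨ %-distribˡ-+ 1 (q ℕ.* g) 2 ⟩
  (1 ℕ.+ (q ℕ.* g) % 2) % 2                ≡⟨ ≡.cong (λ t → (1 ℕ.+ t) % 2) (%-distribˡ-* q g 2) ⟩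
  (1 ℕ.+ (q % 2 ℕ.* (g % 2)) % 2) % 2      ≡⟨ ≡.cong (λ t → (1 ℕ.+ (t ℕ.* (g % 2)) % 2) % 2) q%2≡0 ⟩
  1                                        ∎
  where
  open ≡.≡-Reasoning
  g = geometric q r

geometric-parity : ∀ q r → q % 2 ≡ 1 → geometric q r % 2 ≡ r % 2
geometric-parity q zero    q%2≡1 = ≡.refl
geometric-parity q (suc r) q%2≡1 = begin
  (1 ℕ.+ q ℕ.* g) % 2                      ≡⟨ %-distribˡ-+ 1 (q ℕ.* g) 2 ⟩
  (1 ℕ.+ (q ℕ.* g) % 2) % 2                ≡⟨ ≡.cong (λ t → (1 ℕ.+ t) % 2) (%-distribˡ-* q g 2) ⟩
  (1 ℕ.+ (q % 2 ℕ.* (g % 2)) % 2) % 2      ≡⟨ ≡.cong (λ t → (1 ℕ.+ (t ℕ.* (g % 2)) % 2) % 2) q%2≡1 ⟩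
  (1 ℕ.+ (1 ℕ.* (g % 2)) % 2) % 2          ≡⟨ ≡.cong (λ t → (1 ℕ.+ t % 2) % 2) (ℕₚ.*-identityˡ (g % 2)) ⟩
  (1 ℕ.+ g % 2 % 2) % 2                    ≡⟨ ≡.cong (λ t → (1 ℕ.+ t % 2) % 2) (geometric-parity q r q%2≡1) ⟩
  (1 ℕ.+ r % 2 % 2) % 2                    ≡⟨ ≡.sym (%-distribˡ-+ 1 (r % 2) 2) ⟩
  (1 ℕ.+ r % 2) % 2                        ≡⟨ ≡.sym (%-distribˡ-+ 1 r 2) ⟩
  suc r % 2                                ∎
  where
  open ≡.≡-Reasoning
  g = geometric q r

half-multiple-even : ∀ k h e ⦃ _ : ℕ.NonZero e ⦄ → e ≡ h ℕ.+ h → k % 2 ≡ 0 → (k ℕ.* h) % e ≡ 0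
half-multiple-even k h e e≡h+h k%2≡0 = begin
  (k ℕ.* h) % e                 ≡⟨ ≡.cong (λ n → (n ℕ.* h) % e) (≡.trans (halves k) (≡.cong (ℕ._+ (j ℕ.+ j)) k%2≡0)) ⟩
  ((j ℕ.+ j) ℕ.* h) % e         ≡⟨ ≡.cong (_% e) (≡.trans (regroup j h) (≡.cong (j ℕ.*_) (≡.sym e≡h+h))) ⟩
  (j ℕ.* e) % e                 ≡⟨ m*n%n≡0 j e ⟩
  0                             ∎
  where
  open ≡.≡-Reasoning
  j = k / 2
  regroup : ∀ j h → (j ℕ.+ j) ℕ.* h ≡ j ℕ.* (h ℕ.+ h)
  regroup = NSolver.solve-∀

half-multiple-odd : ∀ k h e ⦃ _ : ℕ.NonZero e ⦄ → e ≡ h ℕ.+ h → k % 2 ≡ 1 → (k ℕ.* h) % e ≡ h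
half-multiple-odd k h e e≡h+h k%2≡1 = begin
  (k ℕ.* h) % e                 ≡⟨ ≡.cong (λ n → (n ℕ.* h) % e) (≡.trans (halves k) (≡.cong (ℕ._+ (j ℕ.+ j)) k%2≡1)) ⟩
  (suc (j ℕ.+ j) ℕ.* h) % e     ≡⟨ ≡.cong (_% e) (≡.trans (regroup j h) (≡.cong (λ n → h ℕ.+ j ℕ.* n) (≡.sym e≡h+h))) ⟩
  (h ℕ.+ j ℕ.* e) % e           ≡⟨ [m+kn]%n≡m%n h j e ⟩
  h % e                         ≡⟨ m<n⇒m%n≡m h<e ⟩
  h                             ∎
  where
  open ≡.≡-Reasoning
  j = k / 2
  regroup : ∀ j h → suc (j ℕ.+ j) ℕ.* h ≡ h ℕ.+ j ℕ.* (h ℕ.+ h)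
  regroup = NSolver.solve-∀
  h<e : h ℕ.< e
  h<e = ≡.subst (h ℕ.<_) (≡.sym e≡h+h) (ℕₚ.m<m+n h (ℕₚ.n≢0⇒n>0 h≢0))
    where
    h≢0 : h ≢ 0
    h≢0 h≡0 = ℕ.≢-nonZero⁻¹ e (≡.trans e≡h+h (≡.cong (λ n → n ℕ.+ n) h≡0))

A-condition-value : ∀ q r a a₀ → (q % 2 ≡ 0 ⊎ r % 2 ≡ 0 → a₀ ≡ 0) → (q % 2 ≡ 1 → r % 2 ≡ 1 → a₀ ℕ.+ a₀ ≡ q ∸ 1) →
                    (if isEven r ∨ isEven q then (a ≡ᵇ 0) else (2 ℕ.* a ≡ᵇ q ∸ 1)) ≡ (a ≡ᵇ a₀)
A-condition-value q r a a₀ zero-class half-class = by-parity (%2≡0⊎%2≡1 q) (%2≡0⊎%2≡1 r)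
  where
  X Y : Bool
  X = a ≡ᵇ 0
  Y = 2 ℕ.* a ≡ᵇ q ∸ 1
  by-parity : q % 2 ≡ 0 ⊎ q % 2 ≡ 1 → r % 2 ≡ 0 ⊎ r % 2 ≡ 1 →
              (if isEven r ∨ isEven q then X else Y) ≡ (a ≡ᵇ a₀)
  by-parity (inj₁ q%2≡0) _ = ≡.trans (≡.cong (λ β → if isEven r ∨ β then X else Y) (isEven-even {q} q%2≡0))
    (≡.trans (≡.cong (λ β → if β then X else Y) (Boolₚ.∨-zeroʳ (isEven r))) (≡.cong (a ≡ᵇ_) (≡.sym (zero-class (inj₁ q%2≡0)))))
  by-parity (inj₂ q%2≡1) (inj₁ r%2≡0) = ≡.trans (≡.cong (λ β → if β ∨ isEven q then X else Y) (isEven-even {r} r%2≡0))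
    (≡.cong (a ≡ᵇ_) (≡.sym (zero-class (inj₂ r%2≡0))))
  by-parity (inj₂ q%2≡1) (inj₂ r%2≡1) = ≡.trans (≡.cong₂ (λ β γ → if β ∨ γ then X else Y) (isEven-odd {r} r%2≡1) (isEven-odd {q} q%2≡1))
    (≡ᵇ-cong (mk⇔ (λ 2a≡q-1 → ℕₚ.*-cancelˡ-≡ a a₀ 2 (≡.trans 2a≡q-1 (≡.trans (≡.sym a₀+a₀≡q-1) (double a₀))))
                  (λ a≡a₀ → ≡.trans (≡.cong (2 ℕ.*_) a≡a₀) (≡.trans (≡.sym (double a₀)) a₀+a₀≡q-1))))
    where
    a₀+a₀≡q-1 = half-class q%2≡1 r%2≡1
    double : ∀ n → n ℕ.+ n ≡ 2 ℕ.* n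
    double n = ≡.cong (n ℕ.+_) (≡.sym (ℕₚ.+-identityʳ n))

𝟙-fromℕ< : ∀ {n a} (a<n : a ℕ.< n) (j : Fin n) → 𝟙 (a ℕ.≟ toℕ j) ≡ δ (Fin.fromℕ< a<n) j
𝟙-fromℕ< a<n j = 𝟙-cong (mk⇔ (λ a≡j → Finₚ.toℕ-injective (≡.trans (Finₚ.toℕ-fromℕ< a<n) a≡j))
                            (λ â≡j → ≡.trans (≡.sym (Finₚ.toℕ-fromℕ< a<n)) (≡.cong toℕ â≡j)))

cyclotomic-subst : ∀ {c ℓ N M} (N≡M : N ≡ M) (F : FiniteFieldWithGenerator c ℓ N) e a b →
                   FiniteFieldWithGenerator.cyclotomic (≡.subst (FiniteFieldWithGenerator c ℓ) N≡M F) e a b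
                   ≡ FiniteFieldWithGenerator.cyclotomic F e a b
cyclotomic-subst ≡.refl F e a b = ≡.refl

module FieldOfSize {c ℓ : Level} (e′ r′ : ℕ) (1≤r′ : 1 ≤ r′)
                             (F : FiniteFieldWithGenerator c ℓ (suc (suc e′) ^ suc r′)) where

  q e k L : ℕ
  q = suc (suc e′)
  e = suc e′
  k = geometric q (suc r′)
  L = k ℕ.* e

  size : q ^ suc r′ ≡ suc L
  size = pow≡1+geometric*e e (suc r′)

  F′ : FiniteFieldWithGenerator c ℓ (suc L)
  F′ = ≡.subst (FiniteFieldWithGenerator c ℓ) size F

  1<L : 1 ℕ.< L
  1<L = ℕₚ.<-≤-trans (s≤s (s≤s z≤n)) (ℕₚ.≤-trans k≥2 (ℕₚ.m≤m*n k e))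
    where
    k≥2 : 2 ≤ k
    k≥2 = s≤s (ℕₚ.*-mono-≤ {1} {q} {1} {geometric q r′} (s≤s z≤n) (geometric-pos q r′ 1≤r′))

  open FieldAlgebra F′ using (-1#)
  open DiscreteLog F′ 1<L using (dlog; dlog-minus-one-even; dlog-minus-one-odd)
  open Cyclotomic F′ 1<L e k ≡.refl
  open Cyclic e
  open LineSums e

  toℕ-κ : ∀ x → toℕ (κ x) ≡ toℕ (dlog x) % e
  toℕ-κ x = toℕ-mod (toℕ (dlog x))

  minus-one-class-q-even : q % 2 ≡ 0 → toℕ (κ -1#) ≡ 0
  minus-one-class-q-even q%2≡0 = ≡.trans (toℕ-κ -1#) (≡.cong (_% e) (dlog-minus-one-odd (L / 2) L-odd))
    where
    L%2≡1 : L % 2 ≡ 1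
    L%2≡1 = ≡.trans (%-distribˡ-* k e 2) (≡.cong₂ (λ s t → (s ℕ.* t) % 2) (geometric-odd q r′ q%2≡0) (%-pred-≡0 {e} {2} q%2≡0))
    L-odd : L ≡ suc (L / 2 ℕ.+ L / 2)
    L-odd = ≡.trans (halves L) (≡.cong (ℕ._+ (L / 2 ℕ.+ L / 2)) L%2≡1)

  module QOdd (q%2≡1 : q % 2 ≡ 1) where
    h : ℕ
    h = e / 2

    e≡h+h : e ≡ h ℕ.+ h
    e≡h+h with %2≡0⊎%2≡1 e
    ... | inj₁ e%2≡0 = ≡.trans (halves e) (≡.cong (ℕ._+ (h ℕ.+ h)) e%2≡0)
    ... | inj₂ e%2≡1 = ⊥-elim (0≢1 (≡.trans (≡.sym (≡.trans (%-distribˡ-+ 1 e 2) (≡.cong (λ t → (1 ℕ.+ t) % 2) e%2≡1))) q%2≡1))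
      where
      0≢1 : 0 ≢ 1
      0≢1 ()

    toℕ-κ-1 : toℕ (κ -1#) ≡ (k ℕ.* h) % e
    toℕ-κ-1 = ≡.trans (toℕ-κ -1#) (≡.cong (_% e) (dlog-minus-one-even (k ℕ.* h)
                (≡.trans (≡.cong (k ℕ.*_) e≡h+h) (ℕₚ.*-distribˡ-+ k h h))))

    minus-one-class-r-even : suc r′ % 2 ≡ 0 → toℕ (κ -1#) ≡ 0
    minus-one-class-r-even r%2≡0 =
      ≡.trans toℕ-κ-1 (half-multiple-even k h e e≡h+h (≡.trans (geometric-parity q (suc r′) q%2≡1) r%2≡0))

    minus-one-class-r-odd : suc r′ % 2 ≡ 1 → toℕ (κ -1#) ≡ h
    minus-one-class-r-odd r%2≡1 =
      ≡.trans toℕ-κ-1 (half-multiple-odd k h e e≡h+h (≡.trans (geometric-parity q (suc r′) q%2≡1) r%2≡1))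

  A-term-correction : ∀ a → A-term q (suc r′) a ≡ 1ℤ ℤ.- + e ℤ.* 𝟙 (a ℕ.≟ toℕ (κ -1#))
  A-term-correction a = ≡.trans (≡.cong (λ β → if β then ℤ.- (+ e′) else + 1)
                                        (≡.trans (A-condition (isEven (suc r′)) (isEven q) (a ≡ᵇ 0) (2 ℕ.* a ≡ᵇ e))
                                                 (A-condition-value q (suc r′) a (toℕ (κ -1#)) class-zero class-half)))
                                (correction-term e′ a (toℕ (κ -1#)))
    where
    class-zero : q % 2 ≡ 0 ⊎ suc r′ % 2 ≡ 0 → toℕ (κ -1#) ≡ 0
    class-zero (inj₁ q%2≡0) = minus-one-class-q-even q%2≡0
    class-zero (inj₂ r%2≡0) = [ minus-one-class-q-even , (λ q%2≡1 → QOdd.minus-one-class-r-even q%2≡1 r%2≡0) ]′ (%2≡0⊎%2≡1 q)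
    class-half : q % 2 ≡ 1 → suc r′ % 2 ≡ 1 → toℕ (κ -1#) ℕ.+ toℕ (κ -1#) ≡ e
    class-half q%2≡1 r%2≡1 = ≡.trans (≡.cong (λ n → n ℕ.+ n) (minus-one-class-r-odd r%2≡1)) (≡.sym e≡h+h)
      where open QOdd q%2≡1

  bound : ∀ a b → a ≤ e′ → b ≤ e′ →
          let D = (+ ((q ∸ 1) ℕ.* (q ∸ 1)) ℤ.* + (FiniteFieldWithGenerator.cyclotomic F (q ∸ 1) a b))
                  ℤ.- M-numerator q (suc r′) a b
              K = (+ (q ∸ 2)) ℤ.* ((+ q) ℤ.- + 3)
          in D ℤ.* D ℤ.≤ (K ℤ.* K) ℤ.* + (q ^ suc r′)
  bound a b a≤e′ b≤e′ = ≡.subst₂ ℤ._≤_ (≡.cong₂ ℤ._*_ deviation≡D deviation≡D) (≡.cong₂ ℤ._*_ (≡.cong₂ ℤ._*_ K≡ K≡) N≡)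
                          (deviation-bound k (κ -1#) cyc cyc-rows cyc-cols cyc-diags cyc-squares â b̂)
    where
    â b̂ : Fin e
    â = Fin.fromℕ< (s≤s a≤e′)
    b̂ = Fin.fromℕ< (s≤s b≤e′)

    N≡ : E ℤ.* + k ℤ.+ 1ℤ ≡ + (q ^ suc r′)
    N≡ = ≡.sym (begin
      + (q ^ suc r′)        ≡⟨ ≡.cong +_ size ⟩
      1ℤ ℤ.+ + (k ℕ.* e)    ≡⟨ ≡.cong (ℤ._+_ 1ℤ) (ℤₚ.pos-* k e) ⟩
      1ℤ ℤ.+ + k ℤ.* E      ≡⟨ ≡.trans (ℤₚ.+-comm 1ℤ (+ k ℤ.* E)) (≡.cong (ℤ._+ 1ℤ) (ℤₚ.*-comm (+ k) E)) ⟩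
      E ℤ.* + k ℤ.+ 1ℤ      ∎)
      where open ≡.≡-Reasoning

    K≡ : (E ℤ.- 1ℤ) ℤ.* (E ℤ.- + 2) ≡ + e′ ℤ.* (+ q ℤ.- + 3)
    K≡ = shift (+ e′)
      where
      shift : ∀ x → (1ℤ ℤ.+ x ℤ.- 1ℤ) ℤ.* (1ℤ ℤ.+ x ℤ.- + 2) ≡ x ℤ.* (1ℤ ℤ.+ (1ℤ ℤ.+ x) ℤ.- + 3)
      shift = ZSolver.solve-∀

    cyc≡ : cyc â b̂ ≡ + FiniteFieldWithGenerator.cyclotomic F e a b
    cyc≡ = ≡.trans (≡.cong₂ (λ i j → + FiniteFieldWithGenerator.cyclotomic F′ e i j) (Finₚ.toℕ-fromℕ< (s≤s a≤e′)) (Finₚ.toℕ-fromℕ< (s≤s b≤e′)))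
                   (≡.cong +_ (cyclotomic-subst size F e a b))

    A≡ : A-term q (suc r′) a ≡ 1ℤ ℤ.- E ℤ.* δ â (κ -1#)
    A≡ = ≡.trans (A-term-correction a) (≡.cong (λ t → 1ℤ ℤ.- E ℤ.* t) (𝟙-fromℕ< (s≤s a≤e′) (κ -1#)))

    B≡ : B-term q b ≡ 1ℤ ℤ.- E ℤ.* δ b̂ 𝟘
    B≡ = ≡.trans (correction-term e′ b 0) (≡.cong (λ t → 1ℤ ℤ.- E ℤ.* t)
                   (≡.trans (≡.cong (λ n → 𝟙 (b ℕ.≟ n)) (≡.sym toℕ-𝟘)) (𝟙-fromℕ< (s≤s b≤e′) 𝟘)))

    C≡ : C-term q a b ≡ 1ℤ ℤ.- E ℤ.* δ â (b̂ ⊕ 𝟘)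
    C≡ = ≡.trans (correction-term e′ a b) (≡.cong (λ t → 1ℤ ℤ.- E ℤ.* t)
                   (≡.trans (≡.cong (λ n → 𝟙 (a ℕ.≟ n)) (≡.sym (Finₚ.toℕ-fromℕ< (s≤s b≤e′))))
                   (≡.trans (𝟙-fromℕ< (s≤s a≤e′) b̂) (≡.cong (δ â) (≡.sym (⊕-identityʳ b̂))))))

    deviation≡D : deviation k (κ -1#) cyc cyc-rows cyc-cols cyc-diags cyc-squares â b̂
                  ≡ + (e ℕ.* e) ℤ.* + FiniteFieldWithGenerator.cyclotomic F e a b ℤ.- M-numerator q (suc r′) a b
    deviation≡D = begin
      E ℤ.* E ℤ.* cyc â b̂ ℤ.+ line (ℤ.- (E ℤ.* + k ℤ.+ 1ℤ ℤ.+ 1ℤ)) E E E (κ -1#) 𝟘 𝟘 â b̂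
        ≡⟨ rearrange E (cyc â b̂) (E ℤ.* + k ℤ.+ 1ℤ) (δ â (κ -1#)) (δ b̂ 𝟘) (δ â (b̂ ⊕ 𝟘)) ⟩
      E ℤ.* E ℤ.* cyc â b̂ ℤ.- ((E ℤ.* + k ℤ.+ 1ℤ ℤ.- + 2) ℤ.+ (1ℤ ℤ.- E ℤ.* δ â (κ -1#))
                               ℤ.+ (1ℤ ℤ.- E ℤ.* δ b̂ 𝟘) ℤ.+ (1ℤ ℤ.- E ℤ.* δ â (b̂ ⊕ 𝟘)))
        ≡⟨ ≡.cong₂ ℤ._-_ (≡.cong₂ ℤ._*_ (≡.sym (ℤₚ.pos-* e e)) cyc≡)
                         (≡.sym (≡.cong₂ ℤ._+_ (≡.cong₂ ℤ._+_ (≡.cong₂ ℤ._+_ (≡.cong (ℤ._- + 2) (≡.sym N≡)) A≡) B≡) C≡)) ⟩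
      + (e ℕ.* e) ℤ.* + FiniteFieldWithGenerator.cyclotomic F e a b ℤ.- M-numerator q (suc r′) a b ∎
      where
      open ≡.≡-Reasoning
      rearrange : ∀ E c N x y z → E ℤ.* E ℤ.* c ℤ.+ (ℤ.- (N ℤ.+ 1ℤ) ℤ.+ E ℤ.* x ℤ.+ E ℤ.* y ℤ.+ E ℤ.* z)
                  ≡ E ℤ.* E ℤ.* c ℤ.- ((N ℤ.- + 2) ℤ.+ (1ℤ ℤ.- E ℤ.* x) ℤ.+ (1ℤ ℤ.- E ℤ.* y) ℤ.+ (1ℤ ℤ.- E ℤ.* z))
      rearrange = ZSolver.solve-∀

cyclotomic-number-bound : ∀ {c ℓ : Level} (q r : ℕ) → 2 ≤ q → 2 ≤ r →
    (F : FiniteFieldWithGenerator c ℓ (q ^ r)) →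
    (a b : ℕ) → a ≤ q ∸ 2 → b ≤ q ∸ 2 →
    let D = (+ ((q ∸ 1) ℕ.* (q ∸ 1)) ℤ.* + (FiniteFieldWithGenerator.cyclotomic F (q ∸ 1) a b))
              ℤ.- M-numerator q r a b
        K = (+ (q ∸ 2)) ℤ.* ((+ q) ℤ.- + 3)
    in D ℤ.* D ℤ.≤ (K ℤ.* K) ℤ.* + (q ^ r)
cyclotomic-number-bound (suc (suc e′)) (suc r′) _          (s≤s 1≤r′) = FieldOfSize.bound e′ r′ 1≤r′
cyclotomic-number-bound (suc zero)     _        (s≤s ()) _

proposition3p2 : ∀ {c ℓ : Level} (p n r : ℕ) → Prime p → 1 ≤ n → 2 ≤ r →
    (F : FiniteFieldWithGenerator c ℓ ((p ^ n) ^ r)) →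
    (a b : ℕ) → a ≤ (p ^ n) ∸ 2 → b ≤ (p ^ n) ∸ 2 →
    let q = p ^ n
        D = (+ ((q ∸ 1) ℕ.* (q ∸ 1)) ℤ.* + (FiniteFieldWithGenerator.cyclotomic F (q ∸ 1) a b))
              ℤ.- M-numerator q r a b
        K = (+ (q ∸ 2)) ℤ.* ((+ q) ℤ.- + 3)
    in D ℤ.* D ℤ.≤ (K ℤ.* K) ℤ.* + (q ^ r)
proposition3p2 p n r p-prime 1≤n 2≤r = cyclotomic-number-bound (p ^ n) r 2≤p^n 2≤r
  where
  2≤p : 2 ≤ p
  2≤p = ℕ.nonTrivial⇒n>1 p ⦃ prime⇒nonTrivial p-prime ⦄
  2≤p^n : 2 ≤ p ^ n
  2≤p^n = ℕₚ.≤-trans 2≤p (≡.subst (_≤ p ^ n) (ℕₚ.*-identityʳ p) (ℕₚ.^-monoʳ-≤ p ⦃ ℕ.>-nonZero (ℕₚ.<-trans (s≤s z≤n) 2≤p) ⦄ 1≤n))
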